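{- Let $G=(V,E)$ be a finite graph (multiple edges and loops allowed) with $n=\#V\ge1$ vertices. For $\pi\in\mathcal{P}(V)$ let $i(E,\pi)$ be the number of edges of $E$ both of whose endpoints lie in the same block of $\pi$ (loops are always counted). Then \[ \frac{1}{(q-1)^{n-1}}\sum_{\pi\in\mathcal{P}(V)} q^{i(E,\pi)}\mu(\pi,\hat1)=\begin{cases} T_G(1,q) & \text{if } G \text{ is connected},\\ 0 & \text{otherwise.}\end{cases} \]
   Context: $q$ is a formal variable. $\mathcal{P}(V)$ is the lattice of set partitions of $V$ ordered by refinement, with maximal element $\hat1$ (the one-block partition) and Möbius function $\mu$. $T_G(x,y)$ is the Tutte polynomial of $G$, determined by: $T_G=1$ if $G$ has no edges; for an edge $e$, $T_G=xT_{G/e}$ if $e$ is a bridge, $T_G=yT_{G\setminus e}$ if $e$ is a loop, and $T_G=T_{G/e}+T_{G\setminus e}$ otherwise (deletion $G\setminus e$, contraction $G/e$). -}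

module Defs where

open import Level using (Level)
open import Data.Nat using (ℕ; zero; suc) renaming (_≡ᵇ_ to _==ℕ_)
open import Data.Fin using (Fin) renaming (_≟_ to _≟F_)
open import Data.Bool using (Bool; true; false; if_then_else_; _∧_; _∨_; not)
open import Data.List using (List; []; _∷_; map; concatMap; foldr; filter; length; upTo; allFin)
open import Data.Bool.ListAction using (any; all)
open import Data.Vec using (Vec; []; _∷_; lookup; replicate)
open import Data.Product using (_×_; _,_; proj₁)
open import Data.List.Membership.Propositional using (_∈_)
open import Relation.Nullary.Decidable using (⌊_⌋)
open import Algebra.Bundles using (CommutativeRing)

-- Finite multigraphs with loops on vertex set Fin n:
-- an edge is a pair of endpoints (read as unordered), E is a list
-- (multiplicities allowed, loops (a , a) allowed).

Edge : ℕ → Set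
Edge n = Fin n × Fin n

Edges : ℕ → Set
Edges n = List (Edge n)

eqF : ∀ {n} → Fin n → Fin n → Bool
eqF a b = ⌊ a ≟F b ⌋

data Walk {n : ℕ} (E : Edges n) : Fin n → Fin n → Set where
  here  : ∀ {u} → Walk E u u
  fwd   : ∀ {a b v} → (a , b) ∈ E → Walk E b v → Walk E a v
  bwd   : ∀ {a b v} → (a , b) ∈ E → Walk E a v → Walk E b v

Connected : ∀ {n} → Edges n → Set
Connected {n} E = (u v : Fin n) → Walk E u v

-- Set partitions of Fin n, encoded by block labels (a restricted growth
-- string read from the last vertex): each partition occurs exactly once
-- in allPartitions n.

Partition : ℕ → Set
Partition n = Vec ℕ n

-- pairs (labelling , number of blocks used so far)
genRGS : (k : ℕ) → List (Vec ℕ k × ℕ)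
genRGS zero = ([] , 0) ∷ []
genRGS (suc k) =
  concatMap (λ { (v , b) → map (λ a → (a ∷ v , (if a ==ℕ b then suc b else b)))
                                  (upTo (suc b)) })
            (genRGS k)

allPartitions : (n : ℕ) → List (Partition n)
allPartitions n = map proj₁ (genRGS n)

sameBlock : ∀ {n} → Partition n → Fin n → Fin n → Bool
sameBlock π i j = lookup π i ==ℕ lookup π j

leqP : ∀ {n} → Partition n → Partition n → Bool
leqP {n} π σ = all (λ i → all (λ j → not (sameBlock π i j) ∨ sameBlock σ i j) (allFin n)) (allFin n)

eqP : ∀ {n} → Partition n → Partition n → Bool
eqP π σ = leqP π σ ∧ leqP σ π

top : (n : ℕ) → Partition n
top n = replicate n 0

iEπ : ∀ {n} → Edges n → Partition n → ℕ
iEπ E π = length (filter (λ e → Data.Bool._≟_ (sameBlock π (Data.Product.proj₁ e) (Data.Product.proj₂ e)) true) E)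

reach : ∀ {n} → ℕ → Edges n → Fin n → Fin n → Bool
reach zero E u v = eqF u v
reach (suc k) E u v =
  reach k E u v ∨ any (λ { (a , b) → (eqF a u ∧ reach k E b v) ∨ (eqF b u ∧ reach k E a v) }) E

-- contraction of the non-loop edge (u , v): identify v with u
-- (v becomes an isolated vertex, which does not affect the Tutte polynomial)
relabel : ∀ {n} → Fin n → Fin n → Fin n → Fin n
relabel u v w = if eqF w v then u else w

contractE : ∀ {n} → Fin n → Fin n → Edges n → Edges n
contractE u v = map (λ { (a , b) → (relabel u v a , relabel u v b) })

module WithRing {c ℓ : Level} (R : CommutativeRing c ℓ) where
  open CommutativeRing R

  pow : Carrier → ℕ → Carrier
  pow x zero = 1#
  pow x (suc k) = x * pow x k

  sumR : List Carrier → Carrier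
  sumR = foldr _+_ 0#

  -- The fuel argument is at least the length of any chain when started at length L.
  mobiusF : {P : Set} → List P → (P → P → Bool) → (P → P → Bool) → ℕ → P → P → Carrier
  mobiusF L le eq zero x y = 0#
  mobiusF L le eq (suc k) x y =
    if eq x y then 1#
    else if le x y then - sumR (map (mobiusF L le eq k x)
                                     (filter (λ z → Data.Bool._≟_ (le x z ∧ le z y ∧ not (eq z y)) true) L))
    else 0#

  μP : ∀ {n} → Partition n → Partition n → Carrier
  μP {n} = mobiusF (allPartitions n) leqP eqP (length (allPartitions n))

  partitionSum : ∀ {n} → Edges n → Carrier → Carrier
  partitionSum {n} E q = sumR (map (λ π → pow q (iEπ E π) * μP π (top n)) (allPartitions n))

  tutteF : ∀ {n} → ℕ → Carrier → Carrier → Edges n → Carrier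
  tutteF k x y [] = 1#
  tutteF zero x y (e ∷ es) = 1#
  tutteF {n} (suc k) x y ((u , v) ∷ es) =
    if eqF u v then y * tutteF k x y es
    else if not (reach n es u v) then x * tutteF k x y (contractE u v es)
    else tutteF k x y (contractE u v es) + tutteF k x y es

  tutte : ∀ {n} → Carrier → Carrier → Edges n → Carrier
  tutte x y E = tutteF (length E) x y E

module Submission where

-- Write S(Γ, E) = Σ_{π ≥ Γ} q^i(E,π) μ(π, 1̂), so that the left-hand side is S(0̂, E). Splitting the terms by
-- whether the endpoints u, v of a non-loop edge e lie in one block of π gives
--   S(Γ, E) = S(Γ, E ∖ e) + (q − 1) S(Γ ∨ uv, E / e),
-- while a loop contributes a factor q. These are the deletion–contraction rules of T(1, q) for the quotient
-- graph G/Γ; for a bridge of G/Γ the graph (G ∖ e)/Γ is disconnected and its term vanishes. With no edges left,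
-- S(Γ, ∅) = Σ_{π ≥ Γ} μ(π, 1̂) = [Γ = 1̂] by Möbius inversion, and G/Γ is connected exactly when Γ = 1̂.
-- Induction on the number of edges thus gives S(Γ, E) = (q − 1)^(#Γ − 1) T_{G/Γ}(1, q) if G/Γ is connected,
-- and 0 otherwise.

open import Defs
open import Level using (Level)
open import Algebra.Bundles using (CommutativeRing)
open import Data.Bool using (Bool; true; false; if_then_else_; _∧_; _∨_; not; T)
import Data.Bool.Properties as Boolₚ
open import Data.Bool.ListAction using (any; all)
open import Data.Empty using (⊥-elim)
open import Data.Fin using (Fin) renaming (_≟_ to _≟F_)
import Data.Fin as Fin
import Data.Fin.Properties as Finₚ
open import Data.List using (List; []; _∷_; map; filter; length; upTo; allFin)
import Data.List.Properties as Listₚ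
open import Data.List.Membership.Propositional using (_∈_; find; lose)
import Data.List.Membership.Propositional.Properties as ∈ₚ
open import Data.List.Relation.Unary.All as All using (All)
open import Data.List.Relation.Unary.AllPairs as AllPairs using (AllPairs; []; _∷_)
import Data.List.Relation.Unary.AllPairs.Properties as AllPairsₚ
open import Data.List.Relation.Unary.Any using (here; there)
import Data.List.Relation.Unary.Any.Properties as Anyₚ
import Data.List.Relation.Unary.All.Properties as Allₚ
import Data.List.Relation.Unary.Unique.Propositional.Properties as Uniqueₚ
open import Data.Nat using (ℕ; zero; suc; _≤_; _<_; z≤n; s≤s) renaming (_≡ᵇ_ to _==ℕ_)
import Data.Nat as Nat
import Data.Nat.Properties as ℕₚ
open import Data.Product using (_×_; _,_; proj₁; proj₂; ∃-syntax)
open import Data.Sum using (_⊎_; inj₁; inj₂)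
open import Function using (_∘_)
open import Function.Bundles using (Equivalence)
open import Data.Vec using (Vec; []; _∷_; lookup; tabulate)
import Data.Vec as Vec
import Data.Vec.Properties as Vecₚ
open import Relation.Binary.PropositionalEquality
  using (_≡_; _≢_; refl; sym; trans; cong; cong₂; subst; subst₂; module ≡-Reasoning)
open import Relation.Nullary using (¬_; yes; no)

true≢false : true ≢ false
true≢false ()

bool-ext : ∀ {a b} → (a ≡ true → b ≡ true) → (b ≡ true → a ≡ true) → a ≡ b
bool-ext {true}  {true}  f g = refl
bool-ext {true}  {false} f g = sym (f refl)
bool-ext {false} {true}  f g = g refl
bool-ext {false} {false} f g = refl

≢true⇒≡false : ∀ {b} → b ≢ true → b ≡ false
≢true⇒≡false {true}  ¬b = ⊥-elim (¬b refl)
≢true⇒≡false {false} ¬b = refl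

mono-≢⇒false-true : ∀ {a b} → a ≢ b → (a ≡ true → b ≡ true) → a ≡ false × b ≡ true
mono-≢⇒false-true {true}  a≢b a⇒b = ⊥-elim (a≢b (sym (a⇒b refl)))
mono-≢⇒false-true {false} {true}  a≢b a⇒b = refl , refl
mono-≢⇒false-true {false} {false} a≢b a⇒b = ⊥-elim (a≢b refl)

∧-not-true⁻ : ∀ {a b} → a ∧ not b ≡ true → a ≡ true × b ≡ false
∧-not-true⁻ {true} {false} _ = refl , refl

∧-not-false⁻ : ∀ {a b} → a ≡ true → a ∧ not b ≡ false → b ≡ true
∧-not-false⁻ {b = true}  _    _  = refl
∧-not-false⁻ {b = false} refl ()

∧-true⁻ : ∀ {a b} → a ∧ b ≡ true → a ≡ true × b ≡ true
∧-true⁻ {true} {true} _ = refl , refl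

∧-true⁺ : ∀ {a b} → a ≡ true → b ≡ true → a ∧ b ≡ true
∧-true⁺ refl refl = refl

∨-true⁻ : ∀ {a b} → a ∨ b ≡ true → a ≡ true ⊎ b ≡ true
∨-true⁻ {true}  _ = inj₁ refl
∨-true⁻ {false} e = inj₂ e

∨-trueˡ : ∀ {a} b → a ≡ true → a ∨ b ≡ true
∨-trueˡ b refl = refl

∨-trueʳ : ∀ a {b} → b ≡ true → a ∨ b ≡ true
∨-trueʳ true  _ = refl
∨-trueʳ false e = e

T⇒true : ∀ {b} → T b → b ≡ true
T⇒true = Equivalence.to Boolₚ.T-≡

true⇒T : ∀ {b} → b ≡ true → T b
true⇒T = Equivalence.from Boolₚ.T-≡

module _ {A : Set} (p : A → Bool) where

  any-true⁻ : ∀ xs → any p xs ≡ true → ∃[ x ] x ∈ xs × p x ≡ true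
  any-true⁻ xs e = let x , x∈xs , px = find (Anyₚ.any⁻ p xs (true⇒T e)) in x , x∈xs , T⇒true px

  any-true⁺ : ∀ {x xs} → x ∈ xs → p x ≡ true → any p xs ≡ true
  any-true⁺ x∈xs px = T⇒true (Anyₚ.any⁺ p (lose x∈xs (true⇒T px)))

  all-true⁻ : ∀ xs → all p xs ≡ true → ∀ {x} → x ∈ xs → p x ≡ true
  all-true⁻ xs e x∈xs = T⇒true (All.lookup (Allₚ.all⁺ p xs (true⇒T e)) x∈xs)

  all-true⁺ : ∀ xs → (∀ {x} → x ∈ xs → p x ≡ true) → all p xs ≡ true
  all-true⁺ xs h = T⇒true (Allₚ.all⁻ p (All.tabulate (true⇒T ∘ h)))

any-cong : ∀ {A : Set} {p p′ : A → Bool} xs → (∀ x → p x ≡ p′ x) → any p xs ≡ any p′ xs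
any-cong []       p≗p′ = refl
any-cong (x ∷ xs) p≗p′ = cong₂ _∨_ (p≗p′ x) (any-cong xs p≗p′)

==ℕ-true⁻ : ∀ {m n} → (m ==ℕ n) ≡ true → m ≡ n
==ℕ-true⁻ {m} {n} e = ℕₚ.≡ᵇ⇒≡ m n (subst T (sym e) _)

==ℕ-true⁺ : ∀ {m n} → m ≡ n → (m ==ℕ n) ≡ true
==ℕ-true⁺ {zero}  refl = refl
==ℕ-true⁺ {suc m} refl = ==ℕ-true⁺ {m} refl

==ℕ-false⁺ : ∀ {m n} → m ≢ n → (m ==ℕ n) ≡ false
==ℕ-false⁺ m≢n = ≢true⇒≡false (λ e → m≢n (==ℕ-true⁻ e))

==ℕ-sym : ∀ m n → (m ==ℕ n) ≡ (n ==ℕ m)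
==ℕ-sym m n = bool-ext (λ e → ==ℕ-true⁺ (sym (==ℕ-true⁻ {m} e))) (λ e → ==ℕ-true⁺ (sym (==ℕ-true⁻ {n} e)))

eqF-true⁻ : ∀ {n} {a b : Fin n} → eqF a b ≡ true → a ≡ b
eqF-true⁻ {a = a} {b} e with a ≟F b
... | yes a≡b = a≡b

eqF-true⁺ : ∀ {n} {a b : Fin n} → a ≡ b → eqF a b ≡ true
eqF-true⁺ {a = a} {b} a≡b with a ≟F b
... | yes _  = refl
... | no a≢b = ⊥-elim (a≢b a≡b)

eqF-false⁺ : ∀ {n} {a b : Fin n} → a ≢ b → eqF a b ≡ false
eqF-false⁺ a≢b = ≢true⇒≡false (λ e → a≢b (eqF-true⁻ e))

eqF-suc : ∀ {n} (a b : Fin n) → eqF (Fin.suc a) (Fin.suc b) ≡ eqF a b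
eqF-suc a b = bool-ext (λ e → eqF-true⁺ (Finₚ.suc-injective (eqF-true⁻ e)))
                       (λ e → eqF-true⁺ (cong Fin.suc (eqF-true⁻ e)))

count : ∀ {n} → (Fin n → Bool) → ℕ
count {zero}  f = 0
count {suc n} f = if f Fin.zero then suc (count (f ∘ Fin.suc)) else count (f ∘ Fin.suc)

count-cong : ∀ {n} {f g : Fin n → Bool} → (∀ w → f w ≡ g w) → count f ≡ count g
count-cong {zero}  f≗g = refl
count-cong {suc n} f≗g rewrite f≗g Fin.zero | count-cong (f≗g ∘ Fin.suc) = refl

count-≤ : ∀ {n} (f : Fin n → Bool) → count f ≤ n
count-≤ {zero}  f = z≤n
count-≤ {suc n} f with f Fin.zero
... | true  = s≤s (count-≤ (f ∘ Fin.suc))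
... | false = ℕₚ.m≤n⇒m≤1+n (count-≤ (f ∘ Fin.suc))

count-mono : ∀ {n} {f g : Fin n → Bool} → (∀ w → f w ≡ true → g w ≡ true) → count f ≤ count g
count-mono {zero}          f⇒g = z≤n
count-mono {suc n} {f} {g} f⇒g with f Fin.zero in f₀ | g Fin.zero in g₀
... | true  | true  = s≤s (count-mono (f⇒g ∘ Fin.suc))
... | true  | false = ⊥-elim (true≢false (trans (sym (f⇒g Fin.zero f₀)) g₀))
... | false | true  = ℕₚ.m≤n⇒m≤1+n (count-mono (f⇒g ∘ Fin.suc))
... | false | false = count-mono (f⇒g ∘ Fin.suc)

count-strict-mono : ∀ {n} {f g : Fin n → Bool} → (∀ w → f w ≡ true → g w ≡ true) →
                    ∀ v → f v ≡ false → g v ≡ true → count f < count g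
count-strict-mono {suc n} {f} {g} f⇒g Fin.zero fv gv rewrite fv | gv = s≤s (count-mono (f⇒g ∘ Fin.suc))
count-strict-mono {suc n} {f} {g} f⇒g (Fin.suc v) fv gv with f Fin.zero in f₀ | g Fin.zero in g₀
... | true  | true  = s≤s (count-strict-mono (f⇒g ∘ Fin.suc) v fv gv)
... | true  | false = ⊥-elim (true≢false (trans (sym (f⇒g Fin.zero f₀)) g₀))
... | false | true  = ℕₚ.m≤n⇒m≤1+n (count-strict-mono (f⇒g ∘ Fin.suc) v fv gv)
... | false | false = count-strict-mono (f⇒g ∘ Fin.suc) v fv gv

count-false : ∀ {n} → count {n} (λ _ → false) ≡ 0
count-false {zero}  = refl
count-false {suc n} = count-false {n}

count-true : ∀ {n} → count {n} (λ _ → true) ≡ n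
count-true {zero}  = refl
count-true {suc n} = cong suc (count-true {n})

count-pos : ∀ {n} {f : Fin n → Bool} v → f v ≡ true → 0 < count f
count-pos {n} {f} v fv = subst (_< count f) (count-false {n}) (count-strict-mono (λ _ ()) v refl fv)

remove : ∀ {n} → (Fin n → Bool) → Fin n → Fin n → Bool
remove f v w = if eqF w v then false else f w

remove-true⁻ : ∀ {n} (f : Fin n → Bool) {v w} → remove f v w ≡ true → f w ≡ true × w ≢ v
remove-true⁻ f {v} {w} e with eqF w v in wv
... | false = e , λ w≡v → true≢false (trans (sym (eqF-true⁺ w≡v)) wv)

remove-true⁺ : ∀ {n} (f : Fin n → Bool) {v w} → f w ≡ true → w ≢ v → remove f v w ≡ true
remove-true⁺ f fw w≢v rewrite eqF-false⁺ w≢v = fw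

remove-suc : ∀ {n} (f : Fin (suc n) → Bool) v w →
             remove (f ∘ Fin.suc) v w ≡ remove f (Fin.suc v) (Fin.suc w)
remove-suc f v w = cong (λ b → if b then false else f (Fin.suc w)) (sym (eqF-suc w v))

count-remove : ∀ {n} {f : Fin n → Bool} v → f v ≡ true → count f ≡ suc (count (remove f v))
count-remove {suc n} {f} Fin.zero fv rewrite fv = cong suc (count-cong {n} (λ _ → refl))
count-remove {suc n} {f} (Fin.suc v) fv with f Fin.zero
... | true  = cong suc (trans (count-remove v fv) (cong suc (count-cong (remove-suc f v))))
... | false = trans (count-remove v fv) (cong suc (count-cong (remove-suc f v)))

count-unique : ∀ {n} {f : Fin n → Bool} r → f r ≡ true →
               (∀ a b → f a ≡ true → f b ≡ true → a ≡ b) → count f ≡ 1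
count-unique {n} {f} r fr unique = trans (count-remove r fr) (cong suc (ℕₚ.n≤0⇒n≡0
  (subst (count (remove f r) ≤_) (count-false {n}) (count-mono only-r))))
  where
  only-r : ∀ w → remove f r w ≡ true → false ≡ true
  only-r w rw = let fw , w≢r = remove-true⁻ f rw in ⊥-elim (w≢r (unique w r fw fr))

module _ {A : Set} where

  countᴸ : (A → Bool) → List A → ℕ
  countᴸ p []       = 0
  countᴸ p (x ∷ xs) = if p x then suc (countᴸ p xs) else countᴸ p xs

  countᴸ-true : ∀ xs → countᴸ (λ _ → true) xs ≡ length xs
  countᴸ-true []       = refl
  countᴸ-true (x ∷ xs) = cong suc (countᴸ-true xs)

  countᴸ-mono : ∀ {p p′ : A → Bool} xs → (∀ {z} → z ∈ xs → p z ≡ true → p′ z ≡ true) →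
                countᴸ p xs ≤ countᴸ p′ xs
  countᴸ-mono         []       p⇒p′ = z≤n
  countᴸ-mono {p} {p′} (x ∷ xs) p⇒p′ with p x in px | p′ x in p′x
  ... | true  | true  = s≤s (countᴸ-mono xs (p⇒p′ ∘ there))
  ... | true  | false = ⊥-elim (true≢false (trans (sym (p⇒p′ (here refl) px)) p′x))
  ... | false | true  = ℕₚ.m≤n⇒m≤1+n (countᴸ-mono xs (p⇒p′ ∘ there))
  ... | false | false = countᴸ-mono xs (p⇒p′ ∘ there)

  countᴸ-strict-mono : ∀ {p p′ : A → Bool} xs → (∀ {z} → z ∈ xs → p z ≡ true → p′ z ≡ true) →
                       ∀ {w} → w ∈ xs → p w ≡ false → p′ w ≡ true → countᴸ p xs < countᴸ p′ xs
  countᴸ-strict-mono (x ∷ xs) p⇒p′ (here refl) pw p′w rewrite pw | p′w = s≤s (countᴸ-mono xs (p⇒p′ ∘ there))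
  countᴸ-strict-mono {p} {p′} (x ∷ xs) p⇒p′ (there w∈xs) pw p′w with p x in px | p′ x in p′x
  ... | true  | true  = s≤s (countᴸ-strict-mono xs (p⇒p′ ∘ there) w∈xs pw p′w)
  ... | true  | false = ⊥-elim (true≢false (trans (sym (p⇒p′ (here refl) px)) p′x))
  ... | false | true  = ℕₚ.m≤n⇒m≤1+n (countᴸ-strict-mono xs (p⇒p′ ∘ there) w∈xs pw p′w)
  ... | false | false = countᴸ-strict-mono xs (p⇒p′ ∘ there) w∈xs pw p′w

  filterᵇ : (A → Bool) → List A → List A
  filterᵇ p = filter (λ z → p z Boolₚ.≟ true)

  filterᵇ-cong : ∀ {p p′ : A → Bool} → (∀ x → p x ≡ p′ x) → ∀ xs → filterᵇ p xs ≡ filterᵇ p′ xs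
  filterᵇ-cong p≗p′ [] = refl
  filterᵇ-cong {p} {p′} p≗p′ (x ∷ xs) with p x | p′ x | p≗p′ x
  ... | true  | .true  | refl = cong (x ∷_) (filterᵇ-cong p≗p′ xs)
  ... | false | .false | refl = filterᵇ-cong p≗p′ xs

  ∈-filterᵇ⁻ : ∀ (p : A → Bool) {z} xs → z ∈ filterᵇ p xs → z ∈ xs × p z ≡ true
  ∈-filterᵇ⁻ p xs = ∈ₚ.∈-filter⁻ (λ z → p z Boolₚ.≟ true)

-- Walks and reachability

module _ {n : ℕ} {E : Edges n} where

  infixr 5 _++ʷ_

  _++ʷ_ : ∀ {a b c} → Walk E a b → Walk E b c → Walk E a c
  here    ++ʷ w′ = w′
  fwd e w ++ʷ w′ = fwd e (w ++ʷ w′)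
  bwd e w ++ʷ w′ = bwd e (w ++ʷ w′)

  reverseʷ : ∀ {a b} → Walk E a b → Walk E b a
  reverseʷ here      = here
  reverseʷ (fwd e w) = reverseʷ w ++ʷ bwd e here
  reverseʷ (bwd e w) = reverseʷ w ++ʷ fwd e here

mapʷ : ∀ {n} {E E′ : Edges n} → (∀ {e} → e ∈ E → e ∈ E′) → ∀ {a b} → Walk E a b → Walk E′ a b
mapʷ f here      = here
mapʷ f (fwd e w) = fwd (f e) (mapʷ f w)
mapʷ f (bwd e w) = bwd (f e) (mapʷ f w)

Walk-[]⇒≡ : ∀ {n} {a b : Fin n} → Walk [] a b → a ≡ b
Walk-[]⇒≡ here = refl

module _ {n : ℕ} {u v : Fin n} {es : Edges n} where

  removeLoopʷ : u ≡ v → ∀ {a b} → Walk ((u , v) ∷ es) a b → Walk es a b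
  removeLoopʷ u≡v here                 = here
  removeLoopʷ u≡v (fwd (here refl) w)  = subst (λ x → Walk es x _) (sym u≡v) (removeLoopʷ u≡v w)
  removeLoopʷ u≡v (fwd (there e) w)    = fwd e (removeLoopʷ u≡v w)
  removeLoopʷ u≡v (bwd (here refl) w)  = subst (λ x → Walk es x _) u≡v (removeLoopʷ u≡v w)
  removeLoopʷ u≡v (bwd (there e) w)    = bwd e (removeLoopʷ u≡v w)

  bypassʷ : Walk es u v → ∀ {a b} → Walk ((u , v) ∷ es) a b → Walk es a b
  bypassʷ p here                = here
  bypassʷ p (fwd (here refl) w) = p ++ʷ bypassʷ p w
  bypassʷ p (fwd (there e) w)   = fwd e (bypassʷ p w)
  bypassʷ p (bwd (here refl) w) = reverseʷ p ++ʷ bypassʷ p w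
  bypassʷ p (bwd (there e) w)   = bwd e (bypassʷ p w)

module _ {n : ℕ} {E : Edges n} where

  open Nat using (_+_; _∸_)

  reach-sound : ∀ k {u v} → reach k E u v ≡ true → Walk E u v
  reach-sound zero    e = subst (Walk E _) (eqF-true⁻ e) here
  reach-sound (suc k) {u} {v} e with ∨-true⁻ {reach k E u v} e
  ... | inj₁ r = reach-sound k r
  ... | inj₂ r with any-true⁻ _ E r
  ... | (a , b) , ab∈E , r′ with ∨-true⁻ {eqF a u ∧ reach k E b v} r′
  ... | inj₁ r″ = let a≡u , r‴ = ∧-true⁻ r″ in
    subst (λ x → Walk E x v) (eqF-true⁻ a≡u) (fwd ab∈E (reach-sound k r‴))
  ... | inj₂ r″ = let b≡u , r‴ = ∧-true⁻ r″ in
    subst (λ x → Walk E x v) (eqF-true⁻ b≡u) (bwd ab∈E (reach-sound k r‴))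

  reach-suc : ∀ k {u v} → reach k E u v ≡ true → reach (suc k) E u v ≡ true
  reach-suc k r = ∨-trueˡ _ r

  reach-+ : ∀ i k {u v} → reach k E u v ≡ true → reach (i + k) E u v ≡ true
  reach-+ zero    k r = r
  reach-+ (suc i) k r = reach-suc (i + k) (reach-+ i k r)

  walk⇒reach : ∀ {u v} → Walk E u v → ∃[ k ] reach k E u v ≡ true
  walk⇒reach here = 0 , eqF-true⁺ refl
  walk⇒reach {u} {v} (fwd {a} {b} ab∈E w) =
    let k , r = walk⇒reach w in
    suc k , ∨-trueʳ (reach k E u v)
              (any-true⁺ _ ab∈E (∨-trueˡ (eqF b u ∧ reach k E u v) (∧-true⁺ (eqF-true⁺ {a = u} refl) r)))
  walk⇒reach {u} {v} (bwd {a} {b} ab∈E w) =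
    let k , r = walk⇒reach w in
    suc k , ∨-trueʳ (reach k E u v)
              (any-true⁺ _ ab∈E (∨-trueʳ (eqF a b ∧ _) (∧-true⁺ (eqF-true⁺ refl) r)))

  reach-suc-cong : ∀ j k {v} → (∀ w → reach j E w v ≡ reach k E w v) →
                   ∀ w → reach (suc j) E w v ≡ reach (suc k) E w v
  reach-suc-cong j k j≗k w = cong₂ _∨_ (j≗k w)
    (any-cong E (λ { (a , b) → cong₂ (λ s t → (eqF a w ∧ s) ∨ (eqF b w ∧ t)) (j≗k b) (j≗k a) }))

  -- The sets {w ∣ reach k E w v} grow with k, and reach (k + 1) depends only on reach k,
  -- so they grow strictly until they stabilise, which happens within n steps.
  Stable : ℕ → Fin n → Set
  Stable j v = ∀ w → reach j E w v ≡ reach (suc j) E w v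

  stable-+ : ∀ {j v} → Stable j v → ∀ i w → reach (i + j) E w v ≡ reach j E w v
  stable-+         st zero    w = refl
  stable-+ {j} {v} st (suc i) w = trans (reach-suc-cong (i + j) j (stable-+ st i) w) (sym (st w))

  stable-or-large : ∀ v k → (∃[ j ] j ≤ k × Stable j v) ⊎ (k < count (λ w → reach k E w v))
  stable-or-large v zero = inj₂ (count-pos v (eqF-true⁺ refl))
  stable-or-large v (suc k) with stable-or-large v k
  ... | inj₁ (j , j≤k , st) = inj₁ (j , ℕₚ.m≤n⇒m≤1+n j≤k , st)
  ... | inj₂ large with Finₚ.all? (λ w → reach k E w v Boolₚ.≟ reach (suc k) E w v)
  ... | yes st = inj₁ (k , ℕₚ.n≤1+n k , st)
  ... | no ¬st with Finₚ.¬∀⟶∃¬ n _ (λ w → reach k E w v Boolₚ.≟ reach (suc k) E w v) ¬st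
  ... | w , changed with mono-≢⇒false-true changed (reach-suc k)
  ... | rk , rk′ = inj₂ (ℕₚ.<-≤-trans (s≤s large) (count-strict-mono (λ _ → reach-suc k) w rk rk′))

  stable-within : ∀ v → ∃[ j ] j ≤ n × Stable j v
  stable-within v with stable-or-large v n
  ... | inj₁ st    = st
  ... | inj₂ large = ⊥-elim (ℕₚ.<-irrefl refl (ℕₚ.<-≤-trans large (count-≤ _)))

  walk⇒reach-n : ∀ {u v} → Walk E u v → reach n E u v ≡ true
  walk⇒reach-n {u} {v} w with walk⇒reach w | stable-within v
  ... | k , r | j , j≤n , st = begin
    reach n E u v                 ≡⟨ cong (λ t → reach t E u v) (ℕₚ.m∸n+n≡m j≤n) ⟨
    reach (n ∸ j + j) E u v       ≡⟨ stable-+ st (n ∸ j) u ⟩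
    reach j E u v                 ≡⟨ stable-+ st (n + k ∸ j) u ⟨
    reach (n + k ∸ j + j) E u v   ≡⟨ cong (λ t → reach t E u v) (ℕₚ.m∸n+n≡m j≤n+k) ⟩
    reach (n + k) E u v           ≡⟨ reach-+ n k r ⟩
    true                          ∎
    where
    open ≡-Reasoning
    j≤n+k = ℕₚ.≤-trans j≤n (ℕₚ.m≤m+n n k)

module _ {n : ℕ} (u v : Fin n) where

  relabel-self : relabel u v v ≡ u
  relabel-self rewrite eqF-true⁺ (refl {x = v}) = refl

  relabel-≢ : ∀ {w} → w ≢ v → relabel u v w ≡ w
  relabel-≢ w≢v rewrite eqF-false⁺ w≢v = refl

  ∈-contractE⁺ : ∀ {es a b} → (a , b) ∈ es → (relabel u v a , relabel u v b) ∈ contractE u v es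
  ∈-contractE⁺ (here refl) = here refl
  ∈-contractE⁺ (there e)   = there (∈-contractE⁺ e)

  ∈-contractE⁻ : ∀ {es x y} → (x , y) ∈ contractE u v es →
                 ∃[ a ] ∃[ b ] (a , b) ∈ es × x ≡ relabel u v a × y ≡ relabel u v b
  ∈-contractE⁻ {(a , b) ∷ es} (here refl) = a , b , here refl , refl , refl
  ∈-contractE⁻ {_ ∷ es}       (there e)   =
    let a , b , ab∈es , x≡ , y≡ = ∈-contractE⁻ e in a , b , there ab∈es , x≡ , y≡

  module _ {es : Edges n} where

    contractʷ : u ≢ v → ∀ {a b} → Walk ((u , v) ∷ es) a b →
                Walk (contractE u v es) (relabel u v a) (relabel u v b)
    contractʷ u≢v here = here
    contractʷ u≢v (fwd {v = z} (here refl) w) =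
      subst (λ x → Walk (contractE u v es) x (relabel u v z)) (trans relabel-self (sym (relabel-≢ u≢v))) (contractʷ u≢v w)
    contractʷ u≢v (fwd (there e) w)   = fwd (∈-contractE⁺ e) (contractʷ u≢v w)
    contractʷ u≢v (bwd {v = z} (here refl) w) =
      subst (λ x → Walk (contractE u v es) x (relabel u v z)) (trans (relabel-≢ u≢v) (sym relabel-self)) (contractʷ u≢v w)
    contractʷ u≢v (bwd (there e) w)   = bwd (∈-contractE⁺ e) (contractʷ u≢v w)

    relabelʷ : ∀ w → Walk ((u , v) ∷ es) w (relabel u v w)
    relabelʷ w with eqF w v in w≡v
    ... | false = here
    ... | true with refl ← eqF-true⁻ w≡v = bwd (here refl) here

    uncontractʷ : ∀ {x y} → Walk (contractE u v es) x y → Walk ((u , v) ∷ es) x y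
    uncontractʷ here = here
    uncontractʷ (fwd e w) with a , b , ab∈es , refl , refl ← ∈-contractE⁻ e =
      reverseʷ (relabelʷ a) ++ʷ fwd (there ab∈es) (relabelʷ b) ++ʷ uncontractʷ w
    uncontractʷ (bwd e w) with a , b , ab∈es , refl , refl ← ∈-contractE⁻ e =
      reverseʷ (relabelʷ b) ++ʷ bwd (there ab∈es) (relabelʷ a) ++ʷ uncontractʷ w

module Sums {c ℓ} (R : CommutativeRing c ℓ) where

  open CommutativeRing R renaming (refl to ≈-refl; sym to ≈-sym; trans to ≈-trans)
  open WithRing R using (sumR)
  open import Algebra.Properties.CommutativeSemigroup +-commutativeSemigroup using (interchange)

  sumIf : {A : Set} → (A → Bool) → (A → Carrier) → List A → Carrier
  sumIf p f xs = sumR (map (λ z → if p z then f z else 0#) xs)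

  module _ {A : Set} where

    sumR-cong : ∀ {f g : A → Carrier} xs → (∀ {z} → z ∈ xs → f z ≈ g z) → sumR (map f xs) ≈ sumR (map g xs)
    sumR-cong []       f≈g = ≈-refl
    sumR-cong (x ∷ xs) f≈g = +-cong (f≈g (here refl)) (sumR-cong xs (f≈g ∘ there))

    sumR-zero : ∀ {f : A → Carrier} xs → (∀ {z} → z ∈ xs → f z ≈ 0#) → sumR (map f xs) ≈ 0#
    sumR-zero []       f≈0 = ≈-refl
    sumR-zero (x ∷ xs) f≈0 = ≈-trans (+-cong (f≈0 (here refl)) (sumR-zero xs (f≈0 ∘ there))) (+-identityˡ 0#)

    sumR-+ : ∀ (f g : A → Carrier) xs → sumR (map (λ z → f z + g z) xs) ≈ sumR (map f xs) + sumR (map g xs)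
    sumR-+ f g []       = ≈-sym (+-identityˡ 0#)
    sumR-+ f g (x ∷ xs) = ≈-trans (+-cong ≈-refl (sumR-+ f g xs)) (interchange _ _ _ _)

    sumR-*ˡ : ∀ a (f : A → Carrier) xs → sumR (map (λ z → a * f z) xs) ≈ a * sumR (map f xs)
    sumR-*ˡ a f []       = ≈-sym (zeroʳ a)
    sumR-*ˡ a f (x ∷ xs) = ≈-trans (+-cong ≈-refl (sumR-*ˡ a f xs)) (≈-sym (distribˡ a _ _))

    sumR-*ʳ : ∀ a (f : A → Carrier) xs → sumR (map (λ z → f z * a) xs) ≈ sumR (map f xs) * a
    sumR-*ʳ a f []       = ≈-sym (zeroˡ a)
    sumR-*ʳ a f (x ∷ xs) = ≈-trans (+-cong ≈-refl (sumR-*ʳ a f xs)) (≈-sym (distribʳ a _ _))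

    sumR-filterᵇ : ∀ (p : A → Bool) (f : A → Carrier) xs → sumR (map f (filterᵇ p xs)) ≈ sumIf p f xs
    sumR-filterᵇ p f []       = ≈-refl
    sumR-filterᵇ p f (x ∷ xs) with p x
    ... | true  = +-cong ≈-refl (sumR-filterᵇ p f xs)
    ... | false = ≈-trans (sumR-filterᵇ p f xs) (≈-sym (+-identityˡ _))

  sumR-swap : ∀ {A B : Set} (F : A → B → Carrier) xs ys →
              sumR (map (λ x → sumR (map (F x) ys)) xs) ≈ sumR (map (λ y → sumR (map (λ x → F x y) xs)) ys)
  sumR-swap F []       ys = ≈-sym (sumR-zero ys (λ _ → ≈-refl))
  sumR-swap F (x ∷ xs) ys =
    ≈-trans (+-cong ≈-refl (sumR-swap F xs ys)) (≈-sym (sumR-+ (F x) (λ y → sumR (map (λ x → F x y) xs)) ys))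

  if-cong : ∀ b {x y : Carrier} → x ≈ y → (if b then x else 0#) ≈ (if b then y else 0#)
  if-cong true  x≈y = x≈y
  if-cong false x≈y = ≈-refl

  if-*ʳ : ∀ b (x y : Carrier) → (if b then x else 0#) * y ≈ (if b then x * y else 0#)
  if-*ʳ true  x y = ≈-refl
  if-*ʳ false x y = zeroˡ y

  if-*ˡ : ∀ b (x y : Carrier) → x * (if b then y else 0#) ≈ (if b then x * y else 0#)
  if-*ˡ true  x y = ≈-refl
  if-*ˡ false x y = zeroʳ x

-- Möbius functions of finite posets

module Möbius {c ℓ} (R : CommutativeRing c ℓ) {P : Set} (L : List P) (le eq : P → P → Bool)
  (eq-def : ∀ x y → eq x y ≡ le x y ∧ le y x)
  (le-refl : ∀ x → le x x ≡ true)
  (le-trans : ∀ {x y z} → le x y ≡ true → le y z ≡ true → le x z ≡ true)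
  (L-distinct : AllPairs (λ x y → eq x y ≡ false) L)
  (⊤ : P) (le-⊤ : ∀ x → le x ⊤ ≡ true) (⊤-listed : ∃[ t ] t ∈ L × eq t ⊤ ≡ true)
  where

  open CommutativeRing R renaming (refl to ≈-refl; sym to ≈-sym; trans to ≈-trans)
  open WithRing R using (sumR; mobiusF)
  open Sums R
  open import Relation.Binary.Reasoning.Setoid setoid
  open import Algebra.Properties.Group +-group using (identityˡ-unique)

  eq⇒le : ∀ {x y} → eq x y ≡ true → le x y ≡ true
  eq⇒le {x} {y} x≈y = proj₁ (∧-true⁻ (trans (sym (eq-def x y)) x≈y))

  eq⇒ge : ∀ {x y} → eq x y ≡ true → le y x ≡ true
  eq⇒ge {x} {y} x≈y = proj₂ (∧-true⁻ (trans (sym (eq-def x y)) x≈y))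

  antisym : ∀ {x y} → le x y ≡ true → le y x ≡ true → eq x y ≡ true
  antisym {x} {y} x≤y y≤x = trans (eq-def x y) (∧-true⁺ x≤y y≤x)

  eq-refl : ∀ x → eq x x ≡ true
  eq-refl x = antisym (le-refl x) (le-refl x)

  eq-sym : ∀ {x y} → eq x y ≡ true → eq y x ≡ true
  eq-sym x≈y = antisym (eq⇒ge x≈y) (eq⇒le x≈y)

  eq-comm : ∀ x y → eq x y ≡ eq y x
  eq-comm x y = bool-ext eq-sym eq-sym

  eq-trans : ∀ {x y z} → eq x y ≡ true → eq y z ≡ true → eq x z ≡ true
  eq-trans x≈y y≈z = antisym (le-trans (eq⇒le x≈y) (eq⇒le y≈z)) (le-trans (eq⇒ge y≈z) (eq⇒ge x≈y))

  le-respˡ : ∀ {x x′} y → eq x x′ ≡ true → le x y ≡ le x′ y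
  le-respˡ y x≈x′ = bool-ext (le-trans (eq⇒ge x≈x′)) (le-trans (eq⇒le x≈x′))

  le-respʳ : ∀ x {y y′} → eq y y′ ≡ true → le x y ≡ le x y′
  le-respʳ x y≈y′ = bool-ext (λ x≤y → le-trans x≤y (eq⇒le y≈y′))
                             (λ x≤y′ → le-trans x≤y′ (eq⇒ge y≈y′))

  eq-respˡ : ∀ {x x′} y → eq x x′ ≡ true → eq x y ≡ eq x′ y
  eq-respˡ y x≈x′ = bool-ext (eq-trans (eq-sym x≈x′)) (eq-trans x≈x′)

  eq-respʳ : ∀ x {y y′} → eq y y′ ≡ true → eq x y ≡ eq x y′
  eq-respʳ x y≈y′ = bool-ext (λ x≈y → eq-trans x≈y y≈y′) (λ x≈y′ → eq-trans x≈y′ (eq-sym y≈y′))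

  -- Elements of P matter only up to eq (partitions are labellings); L lists one element of each class.
  Listed : P → Set
  Listed y = ∃[ y′ ] y′ ∈ L × eq y′ y ≡ true

  listed : ∀ {y} → y ∈ L → Listed y
  listed {y} y∈L = y , y∈L , eq-refl y

  below : P → P → Bool
  below y z = le z y ∧ not (eq z y)

  between : P → P → P → Bool
  between x y z = le x z ∧ below y z

  -- A strict chain below y has at most height y elements, so this much fuel suffices for mobiusF.
  height : P → ℕ
  height y = countᴸ (below y) L

  below-eq : ∀ {y z} → eq z y ≡ true → below y z ≡ false
  below-eq {y} {z} z≈y rewrite z≈y = Boolₚ.∧-zeroʳ (le z y)

  height<length : ∀ {y} → Listed y → height y < length L
  height<length {y} (y′ , y′∈L , y′≈y) = subst (height y <_) (countᴸ-true L)
    (countᴸ-strict-mono L (λ _ _ → refl) y′∈L (below-eq y′≈y) refl)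

  height-below : ∀ {y z} → z ∈ L → below y z ≡ true → height z < height y
  height-below {y} {z} z∈L z<y = countᴸ-strict-mono L below-trans z∈L (below-eq (eq-refl z)) z<y
    where
    below-trans : ∀ {w} → w ∈ L → below z w ≡ true → below y w ≡ true
    below-trans {w} _ w<z with ∧-not-true⁻ w<z | ∧-not-true⁻ z<y
    ... | w≤z , w≉z | z≤y , z≉y with eq w y in w≈y
    ... | true  = ⊥-elim (true≢false (trans (sym (antisym w≤z (le-trans z≤y (eq⇒ge w≈y)))) w≉z))
    ... | false rewrite le-trans w≤z z≤y = refl

  mobius : ℕ → P → P → Carrier
  mobius = mobiusF L le eq

  μ-step : P → P → List Carrier → Carrier
  μ-step x y vs = if eq x y then 1# else if le x y then - sumR vs else 0#

  mobius-resp-eqʳ : ∀ k x {y y′} → eq y y′ ≡ true → mobius k x y ≡ mobius k x y′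
  mobius-resp-eqʳ zero    x y≈y′ = refl
  mobius-resp-eqʳ (suc k) x {y} {y′} y≈y′
    rewrite eq-respʳ x y≈y′ | le-respʳ x y≈y′
          | filterᵇ-cong {p = between x y} {between x y′}
              (λ z → cong₂ (λ a b → le x z ∧ a ∧ not b) (le-respʳ z y≈y′) (eq-respʳ z y≈y′)) L
    = refl

  mobius-resp-eqˡ : ∀ k {x x′} y → eq x x′ ≡ true → mobius k x y ≡ mobius k x′ y
  mobius-resp-eqˡ zero    y x≈x′ = refl
  mobius-resp-eqˡ (suc k) {x} {x′} y x≈x′
    rewrite eq-respˡ y x≈x′ | le-respˡ y x≈x′
          | filterᵇ-cong {p = between x y} {between x′ y} (λ z → cong (_∧ below y z) (le-respˡ z x≈x′)) L
          | Listₚ.map-cong-local {f = mobius k x} {mobius k x′} {filterᵇ (between x′ y) L}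
              (All.tabulate (λ {z} _ → mobius-resp-eqˡ k z x≈x′))
    = refl

  height-between : ∀ {x y z} → z ∈ filterᵇ (between x y) L → height z < height y
  height-between {x} {y} {z} z∈ =
    let z∈L , x≤z<y = ∈-filterᵇ⁻ (between x y) L z∈ in height-below z∈L (proj₂ (∧-true⁻ {le x z} x≤z<y))

  mobius-fuel : ∀ {k k′} x y → height y < k → k ≤ k′ → mobius k′ x y ≡ mobius k x y
  mobius-fuel {suc k} {suc k′} x y hy (s≤s k≤k′) = cong (μ-step x y) (Listₚ.map-cong-local (All.tabulate λ z∈ →
    mobius-fuel x _ (ℕₚ.<-≤-trans (height-between z∈) (ℕₚ.≤-pred hy)) k≤k′))

  μ : P → P → Carrier
  μ = mobius (length L)

  μ-unfold : ∀ x {y} → Listed y → μ x y ≡ μ-step x y (map (μ x) (filterᵇ (between x y) L))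
  μ-unfold x {y} y-listed with length L | height<length y-listed
  ... | suc k | hy = cong (μ-step x y) (Listₚ.map-cong-local (All.tabulate λ z∈ →
    sym (mobius-fuel x _ (ℕₚ.<-≤-trans (height-between z∈) (ℕₚ.≤-pred hy)) (ℕₚ.n≤1+n k))))

  μ-diag : ∀ {x y} → eq x y ≡ true → Listed y → μ x y ≡ 1#
  μ-diag {x} x≈y y-listed rewrite μ-unfold x y-listed | x≈y = refl

  μ-strict : ∀ {x y} → eq x y ≡ false → le x y ≡ true → Listed y →
             μ x y ≡ - sumR (map (μ x) (filterᵇ (between x y) L))
  μ-strict {x} x≉y x≤y y-listed rewrite μ-unfold x y-listed | x≉y | x≤y = refl

  -- L lists each class once, so summing over the class of a listed w picks a single term.
  sum-class : ∀ {w} → Listed w → (f : P → Carrier) → (∀ {z} → z ∈ L → eq z w ≡ true → f z ≈ f w) →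
              sumIf (λ z → eq z w) f L ≈ f w
  sum-class {w} (w′ , w′∈L , w′≈w) f f-resp = go L-distinct w′∈L f-resp
    where
    go : ∀ {xs} → AllPairs (λ x y → eq x y ≡ false) xs → w′ ∈ xs →
         (∀ {z} → z ∈ xs → eq z w ≡ true → f z ≈ f w) → sumIf (λ z → eq z w) f xs ≈ f w
    go {a ∷ xs} (a≉xs ∷ distinct) w′∈ f-resp with eq a w in a≈w
    ... | true = ≈-trans (+-cong (f-resp (here refl) a≈w) (sumR-zero xs rest-zero)) (+-identityʳ (f w))
      where
      rest-zero : ∀ {z} → z ∈ xs → (if eq z w then f z else 0#) ≈ 0#
      rest-zero {z} z∈xs with eq z w in z≈w
      ... | true  = ⊥-elim (true≢false (trans (sym (eq-trans a≈w (eq-sym z≈w))) (All.lookup a≉xs z∈xs)))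
      ... | false = ≈-refl
    ... | false with w′∈
    ...   | here refl  = ⊥-elim (true≢false (trans (sym w′≈w) a≈w))
    ...   | there w′∈xs = ≈-trans (+-identityˡ _) (go distinct w′∈xs (f-resp ∘ there))

  δ : P → P → Carrier
  δ x y = if eq x y then 1# else 0#

  interval-split : ∀ x {w} → Listed w →
    sumIf (λ z → le x z ∧ le z w) (μ x) L ≈ sumIf (between x w) (μ x) L + (if le x w then μ x w else 0#)
  interval-split x {w} w-listed = begin
    sumIf (λ z → le x z ∧ le z w) (μ x) L
      ≈⟨ sumR-cong L split ⟩
    sumR (map (λ z → (if between x w z then μ x z else 0#) + (if eq z w then top-term z else 0#)) L)
      ≈⟨ sumR-+ _ _ L ⟩
    sumIf (between x w) (μ x) L + sumIf (λ z → eq z w) top-term L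
      ≈⟨ +-cong ≈-refl (sum-class w-listed top-term (λ _ z≈w → reflexive (cong (λ m → if le x w then m else 0#)
                                                                        (mobius-resp-eqʳ (length L) x z≈w)))) ⟩
    sumIf (between x w) (μ x) L + top-term w ∎
    where
    top-term : P → Carrier
    top-term z = if le x w then μ x z else 0#
    split : ∀ {z} → z ∈ L → (if le x z ∧ le z w then μ x z else 0#) ≈
                            (if between x w z then μ x z else 0#) + (if eq z w then top-term z else 0#)
    split {z} _ with eq z w in z≈w
    ... | true rewrite eq⇒le z≈w | sym (le-respʳ x z≈w) with le x z
    ...   | true  = ≈-sym (+-identityˡ _)
    ...   | false = ≈-sym (+-identityˡ _)
    split {z} _ | false rewrite Boolₚ.∧-identityʳ (le z w) = ≈-sym (+-identityʳ _)

  between-eq : ∀ {x w} → eq x w ≡ true → sumIf (between x w) (μ x) L ≈ 0#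
  between-eq {x} {w} x≈w = sumR-zero L term-zero
    where
    term-zero : ∀ {z} → z ∈ L → (if between x w z then μ x z else 0#) ≈ 0#
    term-zero {z} _ with between x w z in x≤z<w
    ... | false = ≈-refl
    ... | true with ∧-true⁻ {le x z} x≤z<w
    ... | x≤z , z<w with ∧-not-true⁻ z<w
    ... | z≤w , z≉w = ⊥-elim (true≢false (trans (sym (antisym z≤w (le-trans (eq⇒ge x≈w) x≤z))) z≉w))

  interval-sum : ∀ x {w} → Listed w → sumIf (λ z → le x z ∧ le z w) (μ x) L ≈ δ x w
  interval-sum x {w} w-listed with eq x w in x≈w
  ... | true = begin
    sumIf (λ z → le x z ∧ le z w) (μ x) L                        ≈⟨ interval-split x w-listed ⟩
    sumIf (between x w) (μ x) L + (if le x w then μ x w else 0#) ≈⟨ +-cong (between-eq x≈w) (reflexive last-term) ⟩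
    0# + 1#                                                       ≈⟨ +-identityˡ 1# ⟩
    1#                                                            ∎
    where
    last-term : (if le x w then μ x w else 0#) ≡ 1#
    last-term rewrite eq⇒le x≈w = μ-diag x≈w w-listed
  ... | false with le x w in x≤w
  ...   | true = begin
    sumIf (λ z → le x z ∧ le z w) (μ x) L       ≈⟨ interval-split x w-listed ⟩
    sumIf (between x w) (μ x) L + (if le x w then μ x w else 0#)
      ≡⟨ cong (λ b → sumIf (between x w) (μ x) L + (if b then μ x w else 0#)) x≤w ⟩
    sumIf (between x w) (μ x) L + μ x w         ≈⟨ +-cong (≈-sym (sumR-filterᵇ (between x w) (μ x) L))
                                                           (reflexive (μ-strict x≈w x≤w w-listed)) ⟩
    sumR (map (μ x) (filterᵇ (between x w) L))
      - sumR (map (μ x) (filterᵇ (between x w) L)) ≈⟨ -‿inverseʳ _ ⟩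
    0#                                           ∎
  ...   | false = sumR-zero L term-zero
    where
    term-zero : ∀ {z} → z ∈ L → (if le x z ∧ le z w then μ x z else 0#) ≈ 0#
    term-zero {z} _ with le x z ∧ le z w in x≤z≤w
    ... | false = ≈-refl
    ... | true  = let x≤z , z≤w = ∧-true⁻ {le x z} x≤z≤w in
                  ⊥-elim (true≢false (trans (sym (le-trans x≤z z≤w)) x≤w))

  up-sum : P → Carrier
  up-sum x = sumIf (le x) (λ z → μ z ⊤) L

  up-sum-resp : ∀ {x x′} → eq x x′ ≡ true → up-sum x ≡ up-sum x′
  up-sum-resp x≈x′ = cong sumR (Listₚ.map-cong-local {xs = L} (All.tabulate (λ {z} _ →
    cong (λ b → if b then μ z ⊤ else 0#) (le-respˡ z x≈x′))))

  convolution : P → Carrier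
  convolution x = sumIf (le x) (λ z → μ x z * up-sum z) L

  -- Expanding up-sum and exchanging the two sums turns the convolution into Σ_w δ(x,w) μ(w,⊤).
  convolution≈μ : ∀ {x} → x ∈ L → convolution x ≈ μ x ⊤
  convolution≈μ {x} x∈L = begin
    convolution x                                   ≈⟨ sumR-cong L expand ⟩
    sumR (map (λ z → sumR (map (F z) L)) L)         ≈⟨ sumR-swap F L L ⟩
    sumR (map (λ w → sumR (map (λ z → F z w) L)) L) ≈⟨ sumR-cong L collapse ⟩
    sumIf (λ w → eq w x) (λ w → μ w ⊤) L            ≈⟨ sum-class (listed x∈L) (λ w → μ w ⊤)
                                                        (λ _ w≈x → reflexive (mobius-resp-eqˡ (length L) ⊤ w≈x)) ⟩
    μ x ⊤                                           ∎
    where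
    F : P → P → Carrier
    F z w = if le x z ∧ le z w then μ x z * μ w ⊤ else 0#

    expand : ∀ {z} → z ∈ L → (if le x z then μ x z * up-sum z else 0#) ≈ sumR (map (F z) L)
    expand {z} _ with le x z
    ... | true  = ≈-trans (≈-sym (sumR-*ˡ (μ x z) _ L)) (sumR-cong L (λ {w} _ → if-*ˡ (le z w) (μ x z) (μ w ⊤)))
    ... | false = ≈-sym (sumR-zero L (λ _ → ≈-refl))

    collapse : ∀ {w} → w ∈ L → sumR (map (λ z → F z w) L) ≈ (if eq w x then μ w ⊤ else 0#)
    collapse {w} w∈L = begin
      sumR (map (λ z → F z w) L)
        ≈⟨ sumR-cong L (λ {z} _ → ≈-sym (if-*ʳ (le x z ∧ le z w) (μ x z) (μ w ⊤))) ⟩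
      sumR (map (λ z → (if le x z ∧ le z w then μ x z else 0#) * μ w ⊤) L)
        ≈⟨ sumR-*ʳ (μ w ⊤) _ L ⟩
      sumIf (λ z → le x z ∧ le z w) (μ x) L * μ w ⊤
        ≈⟨ *-cong (interval-sum x (listed w∈L)) ≈-refl ⟩
      δ x w * μ w ⊤
        ≈⟨ if-*ʳ (eq x w) 1# (μ w ⊤) ⟩
      (if eq x w then 1# * μ w ⊤ else 0#)
        ≡⟨ cong (λ b → if b then 1# * μ w ⊤ else 0#) (eq-comm x w) ⟩
      (if eq w x then 1# * μ w ⊤ else 0#)
        ≈⟨ if-cong (eq w x) (*-identityˡ (μ w ⊤)) ⟩
      (if eq w x then μ w ⊤ else 0#)
        ∎

  above : P → P → Bool
  above x z = le x z ∧ not (eq z x)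

  convolution-split : ∀ {x} → x ∈ L → convolution x ≈ up-sum x + sumIf (above x) (λ z → μ x z * up-sum z) L
  convolution-split {x} x∈L = begin
    convolution x
      ≈⟨ sumR-cong L split ⟩
    sumR (map (λ z → (if eq z x then μ x z * up-sum z else 0#) + (if above x z then μ x z * up-sum z else 0#)) L)
      ≈⟨ sumR-+ _ _ L ⟩
    sumIf (λ z → eq z x) (λ z → μ x z * up-sum z) L + sumIf (above x) (λ z → μ x z * up-sum z) L
      ≈⟨ +-cong (sum-class (listed x∈L) _ (λ _ z≈x → reflexive (cong₂ _*_ (mobius-resp-eqʳ (length L) x z≈x)
                                                                           (up-sum-resp z≈x))))
                ≈-refl ⟩
    μ x x * up-sum x + sumIf (above x) (λ z → μ x z * up-sum z) L
      ≈⟨ +-cong (≈-trans (*-cong (reflexive (μ-diag (eq-refl x) (listed x∈L))) ≈-refl) (*-identityˡ _)) ≈-refl ⟩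
    up-sum x + sumIf (above x) (λ z → μ x z * up-sum z) L ∎
    where
    split : ∀ {z} → z ∈ L → (if le x z then μ x z * up-sum z else 0#) ≈
            (if eq z x then μ x z * up-sum z else 0#) + (if above x z then μ x z * up-sum z else 0#)
    split {z} _ with eq z x in z≈x
    ... | true rewrite eq⇒ge z≈x = ≈-sym (+-identityʳ _)
    ... | false rewrite Boolₚ.∧-identityʳ (le x z) = ≈-sym (+-identityˡ _)

  -- Given the identity for every z strictly above x, only z ≈ ⊤ contributes to the strict part.
  above-convolution : ∀ {x} → (∀ {z} → z ∈ L → above x z ≡ true → up-sum z ≈ δ z ⊤) →
                      sumIf (above x) (λ z → μ x z * up-sum z) L ≈ (if eq x ⊤ then 0# else μ x ⊤)
  above-convolution {x} ih = begin
    sumIf (above x) (λ z → μ x z * up-sum z) L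
      ≈⟨ sumR-cong L term ⟩
    sumIf (λ z → eq z ⊤) (λ z → if eq x ⊤ then 0# else μ x z) L
      ≈⟨ sum-class ⊤-listed _ (λ _ z≈⊤ → reflexive (cong (λ m → if eq x ⊤ then 0# else m)
                                                         (mobius-resp-eqʳ (length L) x z≈⊤))) ⟩
    (if eq x ⊤ then 0# else μ x ⊤) ∎
    where
    δ-value : Bool → Carrier
    δ-value b = if b then 1# else 0#
    term : ∀ {z} → z ∈ L → (if above x z then μ x z * up-sum z else 0#) ≈
                           (if eq z ⊤ then (if eq x ⊤ then 0# else μ x z) else 0#)
    term {z} z∈L with above x z in x<z | eq z ⊤ in z≈⊤
    ... | false | false = ≈-refl
    ... | true  | false = ≈-trans (*-cong ≈-refl (≈-trans (ih z∈L x<z) (reflexive (cong δ-value z≈⊤))))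
                                  (zeroʳ (μ x z))
    ... | true | true = ≈-trans (*-cong ≈-refl (≈-trans (ih z∈L x<z) (reflexive (cong δ-value z≈⊤))))
                                (≈-trans (*-identityʳ (μ x z))
                                         (reflexive (cong (λ b → if b then 0# else μ x z) (sym x≉⊤))))
      where
      x≉⊤ : eq x ⊤ ≡ false
      x≉⊤ = trans (sym (eq-respʳ x z≈⊤)) (trans (eq-comm x z) (proj₂ (∧-not-true⁻ x<z)))
    ... | false | true = reflexive (cong (λ b → if b then 0# else μ x z) (sym x≈⊤))
      where
      x≈⊤ : eq x ⊤ ≡ true
      x≈⊤ = eq-trans (eq-sym (∧-not-false⁻ (trans (le-respʳ x z≈⊤) (le-⊤ x)) x<z)) z≈⊤

  up-count : P → ℕ
  up-count x = countᴸ (le x) L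

  up-count-above : ∀ {x z} → x ∈ L → above x z ≡ true → up-count z < up-count x
  up-count-above {x} {z} x∈L x<z = countᴸ-strict-mono L (λ _ → le-trans x≤z) x∈L z≰x (le-refl x)
    where
    x≤z = proj₁ (∧-not-true⁻ x<z)
    z≰x : le z x ≡ false
    z≰x = ≢true⇒≡false (λ z≤x → true≢false (trans (sym (antisym z≤x x≤z)) (proj₂ (∧-not-true⁻ x<z))))

  -- The recursion of mobiusF gives interval-sum directly; this dual identity follows by induction
  -- downwards from ⊤, comparing the two evaluations of convolution x.
  up-sum-δ : ∀ {x} → x ∈ L → up-sum x ≈ δ x ⊤
  up-sum-δ {x} = go (suc (up-count x)) (ℕₚ.n<1+n (up-count x))
    where
    go : ∀ N {x} → up-count x < N → x ∈ L → up-sum x ≈ δ x ⊤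
    go (suc N) {x} bound x∈L with eq x ⊤ in x≈⊤ | key
      where
      ih : ∀ {z} → z ∈ L → above x z ≡ true → up-sum z ≈ δ z ⊤
      ih z∈L x<z = go N (ℕₚ.<-≤-trans (up-count-above x∈L x<z) (ℕₚ.≤-pred bound)) z∈L
      key : up-sum x + (if eq x ⊤ then 0# else μ x ⊤) ≈ μ x ⊤
      key = ≈-trans (≈-sym (≈-trans (convolution-split x∈L) (+-cong ≈-refl (above-convolution ih))))
                    (convolution≈μ x∈L)
    ... | true  | key′ = ≈-trans (≈-sym (+-identityʳ _)) (≈-trans key′ (reflexive (μ-diag x≈⊤ ⊤-listed)))
    ... | false | key′ = identityˡ-unique _ _ key′

-- Set partitions

module _ {n : ℕ} where

  _⊑_ : Partition n → Partition n → Set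
  π ⊑ σ = ∀ i j → sameBlock π i j ≡ true → sameBlock σ i j ≡ true

  _≋_ : Partition n → Partition n → Set
  π ≋ σ = ∀ i j → sameBlock π i j ≡ sameBlock σ i j

  sameBlock-true⁻ : ∀ (π : Partition n) {i j} → sameBlock π i j ≡ true → lookup π i ≡ lookup π j
  sameBlock-true⁻ π {i} = ==ℕ-true⁻ {lookup π i}

  sameBlock-true⁺ : ∀ (π : Partition n) {i j} → lookup π i ≡ lookup π j → sameBlock π i j ≡ true
  sameBlock-true⁺ π {i} = ==ℕ-true⁺ {lookup π i}

  sameBlock-refl : ∀ (π : Partition n) i → sameBlock π i i ≡ true
  sameBlock-refl π i = sameBlock-true⁺ π refl

  sameBlock-sym : ∀ (π : Partition n) i j → sameBlock π i j ≡ sameBlock π j i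
  sameBlock-sym π i j = ==ℕ-sym (lookup π i) (lookup π j)

  sameBlock-trans : ∀ (π : Partition n) {i j k} →
                    sameBlock π i j ≡ true → sameBlock π j k ≡ true → sameBlock π i k ≡ true
  sameBlock-trans π ij jk = sameBlock-true⁺ π (trans (sameBlock-true⁻ π ij) (sameBlock-true⁻ π jk))

  leqP-true⁻ : ∀ π σ → leqP π σ ≡ true → π ⊑ σ
  leqP-true⁻ π σ π≤σ i j =
    impl⁻ (all-true⁻ _ (allFin n) (all-true⁻ _ (allFin n) π≤σ (∈ₚ.∈-allFin i)) (∈ₚ.∈-allFin j))
    where
    impl⁻ : ∀ {a b} → not a ∨ b ≡ true → a ≡ true → b ≡ true
    impl⁻ {true} e refl = e

  leqP-true⁺ : ∀ π σ → π ⊑ σ → leqP π σ ≡ true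
  leqP-true⁺ π σ π⊑σ = all-true⁺ _ (allFin n) λ {i} _ → all-true⁺ _ (allFin n) λ {j} _ → impl⁺ (π⊑σ i j)
    where
    impl⁺ : ∀ {a b} → (a ≡ true → b ≡ true) → not a ∨ b ≡ true
    impl⁺ {true}  a⇒b = a⇒b refl
    impl⁺ {false} a⇒b = refl

  leqP-refl : ∀ π → leqP π π ≡ true
  leqP-refl π = leqP-true⁺ π π (λ _ _ ij → ij)

  leqP-trans : ∀ {π σ τ} → leqP π σ ≡ true → leqP σ τ ≡ true → leqP π τ ≡ true
  leqP-trans {π} {σ} {τ} π≤σ σ≤τ =
    leqP-true⁺ π τ (λ i j ij → leqP-true⁻ σ τ σ≤τ i j (leqP-true⁻ π σ π≤σ i j ij))

  leqP-respˡ : ∀ {π σ} τ → π ≋ σ → leqP π τ ≡ leqP σ τ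
  leqP-respˡ {π} {σ} τ π≋σ = bool-ext
    (λ π≤τ → leqP-true⁺ σ τ (λ i j ij → leqP-true⁻ π τ π≤τ i j (trans (π≋σ i j) ij)))
    (λ σ≤τ → leqP-true⁺ π τ (λ i j ij → leqP-true⁻ σ τ σ≤τ i j (trans (sym (π≋σ i j)) ij)))

  eqP-true⁻ : ∀ π σ → eqP π σ ≡ true → π ≋ σ
  eqP-true⁻ π σ π≈σ i j =
    let π≤σ , σ≤π = ∧-true⁻ {leqP π σ} π≈σ in
    bool-ext (leqP-true⁻ π σ π≤σ i j) (leqP-true⁻ σ π σ≤π i j)

  eqP-true⁺ : ∀ π σ → π ≋ σ → eqP π σ ≡ true
  eqP-true⁺ π σ π≋σ = ∧-true⁺ (leqP-true⁺ π σ (λ i j → subst (_≡ true) (π≋σ i j)))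
                                  (leqP-true⁺ σ π (λ i j → subst (_≡ true) (sym (π≋σ i j))))

  sameBlock-top : ∀ i j → sameBlock (top n) i j ≡ true
  sameBlock-top i j = sameBlock-true⁺ (top n) (trans (Vecₚ.lookup-replicate i 0) (sym (Vecₚ.lookup-replicate j 0)))

  leqP-top : ∀ π → leqP π (top n) ≡ true
  leqP-top π = leqP-true⁺ π (top n) (λ i j _ → sameBlock-top i j)

UsesExactly : ∀ {k} → Vec ℕ k → ℕ → Set
UsesExactly v b = (∀ i → lookup v i < b) × (∀ a → a < b → ∃[ i ] lookup v i ≡ a)

extend : ∀ {k} → Vec ℕ k × ℕ → ℕ → Vec ℕ (suc k) × ℕ
extend (v , b) a = a ∷ v , (if a ==ℕ b then suc b else b)

extensions : ∀ {k} → Vec ℕ k × ℕ → List (Vec ℕ (suc k) × ℕ)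
extensions (v , b) = map (extend (v , b)) (upTo (suc b))

∈-genRGS-suc⁻ : ∀ {k x} → x ∈ genRGS (suc k) → ∃[ p ] p ∈ genRGS k × ∃[ a ] a < suc (proj₂ p) × x ≡ extend p a
∈-genRGS-suc⁻ {k} x∈ with (v , b) , p∈ , x∈ext ← find (∈ₚ.∈-concatMap⁻ extensions {xs = genRGS k} x∈)
  with a , a∈ , refl ← ∈ₚ.∈-map⁻ _ x∈ext = (v , b) , p∈ , a , ∈ₚ.∈-upTo⁻ a∈ , refl

∈-genRGS-suc⁺ : ∀ {k p a} → p ∈ genRGS k → a < suc (proj₂ p) → extend p a ∈ genRGS (suc k)
∈-genRGS-suc⁺ p∈ a≤b = ∈ₚ.∈-concatMap⁺ extensions (lose p∈ (∈ₚ.∈-map⁺ _ (∈ₚ.∈-upTo⁺ a≤b)))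

genRGS-usesExactly : ∀ k {v b} → (v , b) ∈ genRGS k → UsesExactly v b
genRGS-usesExactly zero (here refl) = (λ ()) , (λ _ ())
genRGS-usesExactly (suc k) x∈ with ∈-genRGS-suc⁻ x∈
... | (v , b) , p∈ , a , a≤b , refl with genRGS-usesExactly k p∈ | a ==ℕ b in a≡b
... | v<b , v-onto | true = v′<b′ , v′-onto
  where
  v′<b′ : ∀ i → lookup (a ∷ v) i < suc b
  v′<b′ Fin.zero    = a≤b
  v′<b′ (Fin.suc i) = ℕₚ.m<n⇒m<1+n (v<b i)
  v′-onto : ∀ a′ → a′ < suc b → ∃[ i ] lookup (a ∷ v) i ≡ a′
  v′-onto a′ a′≤b with ℕₚ.m<1+n⇒m<n∨m≡n a′≤b
  ... | inj₁ a′<b = let i , vi≡a′ = v-onto a′ a′<b in Fin.suc i , vi≡a′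
  ... | inj₂ a′≡b = Fin.zero , trans (==ℕ-true⁻ {a} a≡b) (sym a′≡b)
... | v<b , v-onto | false = v′<b , v′-onto
  where
  a<b : a < b
  a<b with ℕₚ.m<1+n⇒m<n∨m≡n a≤b
  ... | inj₁ a<b = a<b
  ... | inj₂ refl = ⊥-elim (true≢false (trans (sym (==ℕ-true⁺ {a} refl)) a≡b))
  v′<b : ∀ i → lookup (a ∷ v) i < b
  v′<b Fin.zero    = a<b
  v′<b (Fin.suc i) = v<b i
  v′-onto : ∀ a′ → a′ < b → ∃[ i ] lookup (a ∷ v) i ≡ a′
  v′-onto a′ a′<b = let i , vi≡a′ = v-onto a′ a′<b in Fin.suc i , vi≡a′

Separated : ∀ {k} → Vec ℕ k → Vec ℕ k → Set
Separated {k} v v′ = ∃[ i ] ∃[ j ] sameBlock v i j ≢ sameBlock v′ i j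

separated-head : ∀ {k} {v : Vec ℕ k} {b a a′} → UsesExactly v b → a < suc b → a′ < suc b → a ≢ a′ →
                 Separated (a ∷ v) (a′ ∷ v)
separated-head {v = v} {b} {a} {a′} (v<b , v-onto) a≤b a′≤b a≢a′ with ℕₚ.m<1+n⇒m<n∨m≡n a≤b
... | inj₁ a<b = let i , vi≡a = v-onto a a<b in
  Fin.zero , Fin.suc i , λ e → true≢false (trans (sym (==ℕ-true⁺ {a} (sym vi≡a)))
                                          (trans e (==ℕ-false⁺ (λ a′≡vi → a≢a′ (trans (sym vi≡a) (sym a′≡vi))))))
... | inj₂ refl with ℕₚ.m<1+n⇒m<n∨m≡n a′≤b
...   | inj₂ a′≡b = ⊥-elim (a≢a′ (sym a′≡b))
...   | inj₁ a′<b = let i , vi≡a′ = v-onto a′ a′<b in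
  Fin.zero , Fin.suc i , λ e → true≢false (trans (sym (==ℕ-true⁺ {a′} (sym vi≡a′)))
                                          (trans (sym e) (==ℕ-false⁺ (λ b≡vi → ℕₚ.<-irrefl (sym b≡vi) (v<b i)))))

genRGS-separated : ∀ k → AllPairs (λ p p′ → Separated (proj₁ p) (proj₁ p′)) (genRGS k)
genRGS-separated zero    = All.[] ∷ []
genRGS-separated (suc k) =
  AllPairsₚ.concat⁺ (All.tabulate within) (AllPairsₚ.map⁺ (AllPairs.map across (genRGS-separated k)))
  where
  within : ∀ {xs} → xs ∈ map extensions (genRGS k) → AllPairs (λ p p′ → Separated (proj₁ p) (proj₁ p′)) xs
  within xs∈ with (v , b) , p∈ , refl ← ∈ₚ.∈-map⁻ extensions xs∈ =
    AllPairsₚ.map⁺ (go (upTo (suc b)) (Uniqueₚ.upTo⁺ (suc b)) (λ a∈ → ∈ₚ.∈-upTo⁻ a∈))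
    where
    go : ∀ as → AllPairs _≢_ as → (∀ {a} → a ∈ as → a < suc b) →
         AllPairs (λ a a′ → Separated (a ∷ v) (a′ ∷ v)) as
    go []       _            _      = []
    go (a ∷ as) (a≢as ∷ uniq) as≤b =
      All.tabulate (λ a′∈ → separated-head (genRGS-usesExactly k p∈) (as≤b (here refl)) (as≤b (there a′∈))
                                           (All.lookup a≢as a′∈))
      ∷ go as uniq (as≤b ∘ there)
  across : ∀ {p p′} → Separated (proj₁ p) (proj₁ p′) →
           All (λ x → All (λ y → Separated (proj₁ x) (proj₁ y)) (extensions p′)) (extensions p)
  across {v , b} {v′ , b′} (i , j , differ) = All.tabulate λ x∈ → All.tabulate λ y∈ →
    separate x∈ y∈
    where
    separate : ∀ {x y} → x ∈ extensions (v , b) → y ∈ extensions (v′ , b′) → Separated (proj₁ x) (proj₁ y)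
    separate x∈ y∈ with _ , _ , refl ← ∈ₚ.∈-map⁻ _ x∈ with _ , _ , refl ← ∈ₚ.∈-map⁻ _ y∈ =
      Fin.suc i , Fin.suc j , differ

≋-∷ : ∀ {k} {v w : Vec ℕ k} {a g} → v ≋ w → (∀ j → (a ==ℕ lookup v j) ≡ (g ==ℕ lookup w j)) →
      (a ∷ v) ≋ (g ∷ w)
≋-∷ {a = a} {g} v≋w head Fin.zero    Fin.zero    = trans (==ℕ-true⁺ {a} refl) (sym (==ℕ-true⁺ {g} refl))
≋-∷             v≋w head Fin.zero    (Fin.suc j) = head j
≋-∷ {v = v} {w} {a} {g} v≋w head (Fin.suc i) Fin.zero =
  trans (==ℕ-sym (lookup v i) a) (trans (head i) (==ℕ-sym g (lookup w i)))
≋-∷             v≋w head (Fin.suc i) (Fin.suc j) = v≋w i j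

-- A new vertex gets the label of an earlier vertex in its block if there is one, and the fresh label otherwise.
genRGS-complete : ∀ k (Γ : Vec ℕ k) → ∃[ p ] p ∈ genRGS k × proj₁ p ≋ Γ
genRGS-complete zero    []      = ([] , 0) , here refl , (λ ())
genRGS-complete (suc k) (g ∷ Γ) with genRGS-complete k Γ
... | (v , b) , p∈ , v≋Γ with genRGS-usesExactly k p∈ | Finₚ.any? (λ i → g ℕₚ.≟ lookup Γ i)
... | v<b , _ | yes (i , g≡Γi) =
  extend (v , b) (lookup v i) , ∈-genRGS-suc⁺ p∈ (ℕₚ.m<n⇒m<1+n (v<b i)) , ≋-∷ v≋Γ head
  where
  head : ∀ j → (lookup v i ==ℕ lookup v j) ≡ (g ==ℕ lookup Γ j)
  head j = trans (v≋Γ i j) (cong (_==ℕ lookup Γ j) (sym g≡Γi))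
... | v<b , _ | no g∉Γ =
  extend (v , b) b , ∈-genRGS-suc⁺ p∈ (ℕₚ.n<1+n b) , ≋-∷ v≋Γ head
  where
  head : ∀ j → (b ==ℕ lookup v j) ≡ (g ==ℕ lookup Γ j)
  head j = trans (==ℕ-false⁺ (λ b≡vj → ℕₚ.<-irrefl (sym b≡vj) (v<b j)))
                 (sym (==ℕ-false⁺ (λ g≡Γj → g∉Γ (j , g≡Γj))))

allPartitions-complete : ∀ {n} (Γ : Partition n) → ∃[ π ] π ∈ allPartitions n × π ≋ Γ
allPartitions-complete {n} Γ =
  let p , p∈ , p≋Γ = genRGS-complete n Γ in proj₁ p , ∈ₚ.∈-map⁺ proj₁ p∈ , p≋Γ

allPartitions-distinct : ∀ n → AllPairs (λ π σ → eqP π σ ≡ false) (allPartitions n)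
allPartitions-distinct n =
  AllPairsₚ.map⁺ (AllPairs.map (λ {p} {p′} → separated⇒≉ (proj₁ p) (proj₁ p′)) (genRGS-separated n))
  where
  separated⇒≉ : ∀ π σ → Separated π σ → eqP π σ ≡ false
  separated⇒≉ π σ (i , j , differ) = ≢true⇒≡false (λ π≈σ → differ (eqP-true⁻ π σ π≈σ i j))

discrete : ∀ n → Partition n
discrete n = tabulate Fin.toℕ

sameBlock-discrete : ∀ {n} {a b : Fin n} → sameBlock (discrete n) a b ≡ true → a ≡ b
sameBlock-discrete {n} {a} {b} ab = Finₚ.toℕ-injective
  (trans (sym (Vecₚ.lookup∘tabulate Fin.toℕ a))
         (trans (sameBlock-true⁻ (discrete n) ab) (Vecₚ.lookup∘tabulate Fin.toℕ b)))

leqP-discrete : ∀ {n} (π : Partition n) → leqP (discrete n) π ≡ true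
leqP-discrete {n} π = leqP-true⁺ (discrete n) π
  (λ i j ij → subst (λ k → sameBlock π i k ≡ true) (sameBlock-discrete ij) (sameBlock-refl π i))

module _ {n : ℕ} (Γ : Partition n) (u v : Fin n) where

  relabelBlock : ℕ → ℕ
  relabelBlock l = if l ==ℕ lookup Γ v then lookup Γ u else l

  merge : Partition n
  merge = Vec.map relabelBlock Γ

  lookup-merge : ∀ i → lookup merge i ≡ relabelBlock (lookup Γ i)
  lookup-merge i = Vecₚ.lookup-map i relabelBlock Γ

  relabelBlock-v : ∀ {l} → lookup Γ v ≡ l → relabelBlock l ≡ lookup Γ u
  relabelBlock-v refl rewrite ==ℕ-true⁺ {lookup Γ v} refl = refl

  relabelBlock-other : ∀ {l} → (l ==ℕ lookup Γ v) ≡ false → relabelBlock l ≡ l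
  relabelBlock-other l≢v rewrite l≢v = refl

  sameBlock-merge : ∀ i j → sameBlock merge i j ≡ (relabelBlock (lookup Γ i) ==ℕ relabelBlock (lookup Γ j))
  sameBlock-merge i j = cong₂ _==ℕ_ (lookup-merge i) (lookup-merge j)

  sameBlock-merge-uv : sameBlock merge u v ≡ true
  sameBlock-merge-uv = trans (sameBlock-merge u v)
    (==ℕ-true⁺ {relabelBlock (lookup Γ u)} (trans u-fixed (sym (relabelBlock-v refl))))
    where
    u-fixed : relabelBlock (lookup Γ u) ≡ lookup Γ u
    u-fixed with lookup Γ u ==ℕ lookup Γ v
    ... | true  = refl
    ... | false = refl

  ⊑-merge : Γ ⊑ merge
  ⊑-merge i j ij = trans (sameBlock-merge i j)
    (==ℕ-true⁺ {relabelBlock (lookup Γ i)} (cong relabelBlock (sameBlock-true⁻ Γ ij)))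

  witness : Fin n → Fin n
  witness i = if lookup Γ i ==ℕ lookup Γ v then u else i

  lookup-witness : ∀ i → lookup Γ (witness i) ≡ relabelBlock (lookup Γ i)
  lookup-witness i with lookup Γ i ==ℕ lookup Γ v
  ... | true  = refl
  ... | false = refl

  sameBlock-witness : ∀ π → Γ ⊑ π → sameBlock π u v ≡ true → ∀ i → sameBlock π i (witness i) ≡ true
  sameBlock-witness π Γ⊑π uv i with lookup Γ i ==ℕ lookup Γ v in iv
  ... | true  = sameBlock-trans π (Γ⊑π i v (sameBlock-true⁺ Γ (==ℕ-true⁻ {lookup Γ i} iv)))
                                  (trans (sameBlock-sym π v u) uv)
  ... | false = sameBlock-refl π i

  merge-⊑ : ∀ π → Γ ⊑ π → sameBlock π u v ≡ true → merge ⊑ π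
  merge-⊑ π Γ⊑π uv i j ij =
    sameBlock-trans π (sameBlock-witness π Γ⊑π uv i)
      (sameBlock-trans π (Γ⊑π (witness i) (witness j) (sameBlock-true⁺ Γ witnesses-agree))
        (trans (sameBlock-sym π (witness j) j) (sameBlock-witness π Γ⊑π uv j)))
    where
    witnesses-agree : lookup Γ (witness i) ≡ lookup Γ (witness j)
    witnesses-agree = trans (lookup-witness i)
      (trans (==ℕ-true⁻ {relabelBlock (lookup Γ i)} (trans (sym (sameBlock-merge i j)) ij)) (sym (lookup-witness j)))

  leqP-merge : ∀ π → leqP merge π ≡ leqP Γ π ∧ sameBlock π u v
  leqP-merge π = bool-ext
    (λ m≤π → ∧-true⁺ (leqP-true⁺ Γ π (λ i j ij → leqP-true⁻ merge π m≤π i j (⊑-merge i j ij)))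
                     (leqP-true⁻ merge π m≤π u v sameBlock-merge-uv))
    (λ e → let Γ≤π , uv = ∧-true⁻ {leqP Γ π} e in leqP-true⁺ merge π (merge-⊑ π (leqP-true⁻ Γ π Γ≤π) uv))

module _ {n : ℕ} (π : Partition n) where

  iEπ-∷ : ∀ a b es → iEπ ((a , b) ∷ es) π ≡ (if sameBlock π a b then suc (iEπ es π) else iEπ es π)
  iEπ-∷ a b es with sameBlock π a b
  ... | true  = refl
  ... | false = refl

  lookup-relabel : ∀ {u v} a → sameBlock π u v ≡ true → lookup π (relabel u v a) ≡ lookup π a
  lookup-relabel {u} {v} a uv with eqF a v in a≡v
  ... | false = refl
  ... | true with refl ← eqF-true⁻ a≡v = sameBlock-true⁻ π uv

  iEπ-contractE : ∀ {u v} es → sameBlock π u v ≡ true → iEπ (contractE u v es) π ≡ iEπ es π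
  iEπ-contractE                []             uv = refl
  iEπ-contractE {u} {v} ((a , b) ∷ es) uv
    rewrite iEπ-∷ (relabel u v a) (relabel u v b) (contractE u v es) | iEπ-∷ a b es
          | lookup-relabel a uv | lookup-relabel b uv | iEπ-contractE es uv = refl

-- Deletion–contraction

module UpperSums {c ℓ} (R : CommutativeRing c ℓ) (q : CommutativeRing.Carrier R) (n : ℕ) where

  open CommutativeRing R renaming (refl to ≈-refl; sym to ≈-sym; trans to ≈-trans)
  open WithRing R
  open Sums R
  open import Relation.Binary.Reasoning.Setoid setoid

  private
    L = allPartitions n

  top-listed : ∃[ t ] t ∈ L × eqP t (top n) ≡ true
  top-listed = let t , t∈L , t≋top = allPartitions-complete (top n) in t , t∈L , eqP-true⁺ t (top n) t≋top

  module M = Möbius R L leqP eqP (λ _ _ → refl) leqP-refl (λ {π} {σ} {τ} → leqP-trans {n} {π} {σ} {τ})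
                    (allPartitions-distinct n) (top n) leqP-top top-listed

  upperSum : Partition n → Edges n → Carrier
  upperSum Γ E = sumIf (leqP Γ) (λ π → pow q (iEπ E π) * μP π (top n)) L

  partitionSum≈upperSum : (E : Edges n) → partitionSum E q ≈ upperSum (discrete n) E
  partitionSum≈upperSum E = sumR-cong L (λ {π} _ →
    reflexive (cong (λ b → if b then pow q (iEπ E π) * μP π (top n) else 0#) (sym (leqP-discrete π))))

  upperSum-[] : ∀ Γ → upperSum Γ [] ≈ (if eqP Γ (top n) then 1# else 0#)
  upperSum-[] Γ with π , π∈L , π≋Γ ← allPartitions-complete Γ = begin
    upperSum Γ []             ≈⟨ sumR-cong L term ⟩
    M.up-sum π                ≈⟨ M.up-sum-δ π∈L ⟩
    M.δ π (top n)             ≡⟨ cong (λ b → if b then 1# else 0#)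
                                      (M.eq-respˡ {π} {Γ} (top n) (eqP-true⁺ π Γ π≋Γ)) ⟩
    (if eqP Γ (top n) then 1# else 0#) ∎
    where
    term : ∀ {σ} → σ ∈ L → (if leqP Γ σ then 1# * μP σ (top n) else 0#) ≈ (if leqP π σ then μP σ (top n) else 0#)
    term {σ} _ = ≈-trans (if-cong (leqP Γ σ) (*-identityˡ _))
                         (reflexive (cong (λ b → if b then μP σ (top n) else 0#) (sym (leqP-respˡ {π = π} {Γ} σ π≋Γ))))

  upperSum-loop : ∀ Γ {u v es} → u ≡ v → upperSum Γ ((u , v) ∷ es) ≈ q * upperSum Γ es
  upperSum-loop Γ {u} {v} {es} refl = ≈-trans (sumR-cong L term) (sumR-*ˡ q _ L)
    where
    term : ∀ {π} → π ∈ L → (if leqP Γ π then pow q (iEπ ((u , v) ∷ es) π) * μP π (top n) else 0#) ≈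
                           q * (if leqP Γ π then pow q (iEπ es π) * μP π (top n) else 0#)
    term {π} _ rewrite iEπ-∷ π u v es | sameBlock-refl π u =
      ≈-trans (if-cong (leqP Γ π) (*-assoc _ _ _)) (≈-sym (if-*ˡ (leqP Γ π) q _))

  q*x≈x+[q-1]*x : ∀ x → q * x ≈ x + (q - 1#) * x
  q*x≈x+[q-1]*x x = begin
    q * x                       ≈⟨ +-identityˡ (q * x) ⟨
    0# + q * x                  ≈⟨ +-cong (-‿inverseʳ x) ≈-refl ⟨
    (x - x) + q * x             ≈⟨ +-assoc x (- x) (q * x) ⟩
    x + (- x + q * x)           ≈⟨ +-cong ≈-refl (+-comm (- x) (q * x)) ⟩
    x + (q * x - x)             ≈⟨ +-cong ≈-refl (+-cong ≈-refl (-‿cong (*-identityˡ x))) ⟨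
    x + (q * x - 1# * x)        ≈⟨ +-cong ≈-refl (+-cong ≈-refl (-‿distribˡ-* 1# x)) ⟩
    x + (q * x + - 1# * x)      ≈⟨ +-cong ≈-refl (distribʳ x q (- 1#)) ⟨
    x + (q - 1#) * x            ∎
    where open import Algebra.Properties.Ring ring using (-‿distribˡ-*)

  -- For π ⊒ Γ with u, v in one block, q^i(E,π) = q^i(E∖e,π) + (q − 1) q^i(E/e,π);
  -- otherwise only the first term occurs.
  upperSum-delete-contract : ∀ Γ u v es →
    upperSum Γ ((u , v) ∷ es) ≈ upperSum Γ es + (q - 1#) * upperSum (merge Γ u v) (contractE u v es)
  upperSum-delete-contract Γ u v es =
    ≈-trans (sumR-cong L term) (≈-trans (sumR-+ _ _ L) (+-cong ≈-refl (sumR-*ˡ (q - 1#) _ L)))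
    where
    term : ∀ {π} → π ∈ L →
      (if leqP Γ π then pow q (iEπ ((u , v) ∷ es) π) * μP π (top n) else 0#) ≈
      (if leqP Γ π then pow q (iEπ es π) * μP π (top n) else 0#) +
      (q - 1#) * (if leqP (merge Γ u v) π then pow q (iEπ (contractE u v es) π) * μP π (top n) else 0#)
    term {π} _ rewrite iEπ-∷ π u v es | leqP-merge Γ u v π with leqP Γ π | sameBlock π u v in uv
    ... | true  | true  rewrite iEπ-contractE π es uv = ≈-trans (*-assoc _ _ _) (q*x≈x+[q-1]*x _)
    ... | true  | false = ≈-sym (≈-trans (+-cong ≈-refl (zeroʳ _)) (+-identityʳ _))
    ... | false | _     = ≈-sym (≈-trans (+-cong ≈-refl (zeroʳ _)) (+-identityʳ _))

module _ {n : ℕ} where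

  ConnectedOn : (Fin n → Bool) → Edges n → Set
  ConnectedOn A E = ∀ a b → A a ≡ true → A b ≡ true → Walk E a b

  Subsingleton : (Fin n → Bool) → Set
  Subsingleton A = ∀ {a b} → A a ≡ true → A b ≡ true → a ≡ b

  -- A contains exactly one vertex of each block of Γ and all endpoints of E, so (A , E) is the quotient graph.
  record Transversal (Γ : Partition n) (A : Fin n → Bool) (E : Edges n) : Set where
    field
      separated : ∀ {a b} → A a ≡ true → A b ≡ true → sameBlock Γ a b ≡ true → a ≡ b
      covering  : ∀ w → ∃[ r ] A r ≡ true × sameBlock Γ w r ≡ true
      endpoints : ∀ {a b} → (a , b) ∈ E → A a ≡ true × A b ≡ true

  transversal-discrete : ∀ E → Transversal (discrete n) (λ _ → true) E
  transversal-discrete E = record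
    { separated = λ _ _ → sameBlock-discrete
    ; covering  = λ w → w , refl , sameBlock-refl (discrete n) w
    ; endpoints = λ _ → refl , refl
    }

  transversal-tail : ∀ {Γ A e es} → Transversal Γ A (e ∷ es) → Transversal Γ A es
  transversal-tail T = record { Transversal T hiding (endpoints) ; endpoints = Transversal.endpoints T ∘ there }

  module _ {Γ A u v es} (T : Transversal Γ A ((u , v) ∷ es)) (u≢v : u ≢ v) where

    open Transversal T

    private
      A′ = remove A v
      Γ′ = merge Γ u v

    remove-relabel : ∀ {a} → A a ≡ true → A′ (relabel u v a) ≡ true
    remove-relabel {a} Aa with eqF a v in a≡v
    ... | true  = remove-true⁺ A (proj₁ (endpoints (here refl))) u≢v
    ... | false = remove-true⁺ A Aa (λ a≡v′ → true≢false (trans (sym (eqF-true⁺ a≡v′)) a≡v))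

    transversal-contract : Transversal Γ′ A′ (contractE u v es)
    transversal-contract = record { separated = separated′ ; covering = covering′ ; endpoints = endpoints′ }
      where
      Av = proj₂ (endpoints (here refl))
      separated′ : ∀ {a b} → A′ a ≡ true → A′ b ≡ true → sameBlock Γ′ a b ≡ true → a ≡ b
      separated′ {a} {b} A′a A′b ab with remove-true⁻ A A′a | remove-true⁻ A A′b
      ... | Aa , a≢v | Ab , b≢v with lookup Γ a ==ℕ lookup Γ v in av | lookup Γ b ==ℕ lookup Γ v in bv
      ... | true  | _    = ⊥-elim (a≢v (separated Aa Av av))
      ... | false | true = ⊥-elim (b≢v (separated Ab Av bv))
      ... | false | false = separated Aa Ab (sameBlock-true⁺ Γ
            (trans (sym (relabelBlock-other Γ u v av))
              (trans (==ℕ-true⁻ {relabelBlock Γ u v (lookup Γ a)} (trans (sym (sameBlock-merge Γ u v a b)) ab))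
                     (relabelBlock-other Γ u v bv))))
      covering′ : ∀ w → ∃[ r ] A′ r ≡ true × sameBlock Γ′ w r ≡ true
      covering′ w with covering w
      ... | r , Ar , wr with r ≟F v
      ... | no  r≢v  = r , remove-true⁺ A Ar r≢v , ⊑-merge Γ u v w r wr
      ... | yes refl = u , remove-true⁺ A (proj₁ (endpoints (here refl))) u≢v ,
                       sameBlock-trans Γ′ (⊑-merge Γ u v w v wr) (trans (sameBlock-sym Γ′ v u) (sameBlock-merge-uv Γ u v))
      endpoints′ : ∀ {a b} → (a , b) ∈ contractE u v es → A′ a ≡ true × A′ b ≡ true
      endpoints′ e with a , b , ab∈es , refl , refl ← ∈-contractE⁻ u v e =
        let Aa , Ab = endpoints (there ab∈es) in remove-relabel Aa , remove-relabel Ab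

    connectedOn-contract : ConnectedOn A ((u , v) ∷ es) → ConnectedOn A′ (contractE u v es)
    connectedOn-contract C a b A′a A′b with remove-true⁻ A A′a | remove-true⁻ A A′b
    ... | Aa , a≢v | Ab , b≢v =
      subst₂ (Walk _) (relabel-≢ u v a≢v) (relabel-≢ u v b≢v) (contractʷ u v u≢v (C a b Aa Ab))

    connectedOn-uncontract : ConnectedOn A′ (contractE u v es) → ConnectedOn A ((u , v) ∷ es)
    connectedOn-uncontract C a b Aa Ab =
      relabelʷ u v a ++ʷ uncontractʷ u v (C _ _ (remove-relabel Aa) (remove-relabel Ab)) ++ʷ reverseʷ (relabelʷ u v b)

  connectedOn-tail : ∀ {A e es} → ConnectedOn A es → ConnectedOn A (e ∷ es)
  connectedOn-tail C a b Aa Ab = mapʷ there (C a b Aa Ab)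

  connectedOn-loop : ∀ {A u v es} → u ≡ v → ConnectedOn A ((u , v) ∷ es) → ConnectedOn A es
  connectedOn-loop u≡v C a b Aa Ab = removeLoopʷ u≡v (C a b Aa Ab)

  connectedOn-bypass : ∀ {A u v es} → Walk es u v → ConnectedOn A ((u , v) ∷ es) → ConnectedOn A es
  connectedOn-bypass p C a b Aa Ab = bypassʷ p (C a b Aa Ab)

  connectedOn-[]⁻ : ∀ {A} → ConnectedOn A [] → Subsingleton A
  connectedOn-[]⁻ C Aa Ab = Walk-[]⇒≡ (C _ _ Aa Ab)

  connectedOn-[]⁺ : ∀ {A} → Subsingleton A → ConnectedOn A []
  connectedOn-[]⁺ single a b Aa Ab = subst (Walk [] a) (single Aa Ab) here

  module _ {Γ A E} (T : Transversal Γ A E) where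

    open Transversal T

    transversal-top⁺ : Subsingleton A → eqP Γ (top n) ≡ true
    transversal-top⁺ single = eqP-true⁺ Γ (top n) λ i j → trans (one-block i j) (sym (sameBlock-top i j))
      where
      one-block : ∀ i j → sameBlock Γ i j ≡ true
      one-block i j with covering i | covering j
      ... | r , Ar , ir | s , As , js rewrite single As Ar = sameBlock-trans Γ ir (trans (sameBlock-sym Γ r j) js)

    transversal-top⁻ : eqP Γ (top n) ≡ true → Subsingleton A
    transversal-top⁻ Γ≈top {a} {b} Aa Ab = separated Aa Ab (trans (eqP-true⁻ Γ (top n) Γ≈top a b) (sameBlock-top a b))

    count-subsingleton : Fin n → Subsingleton A → count A ≡ 1
    count-subsingleton w single = let r , Ar , _ = covering w in count-unique r Ar (λ _ _ → single)

module TutteExpansion {c ℓ} (R : CommutativeRing c ℓ) (q : CommutativeRing.Carrier R) (m : ℕ) where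

  open CommutativeRing R renaming (refl to ≈-refl; sym to ≈-sym; trans to ≈-trans)
  open WithRing R
  open UpperSums R q (suc m)
  open import Relation.Binary.Reasoning.Setoid setoid
  open import Algebra.Properties.CommutativeSemigroup *-commutativeSemigroup using (x∙yz≈y∙xz; x∙yz≈yx∙z)

  -- Used with count A + d = n, so that for a connected quotient graph upperSum Γ E = (q − 1)^(#blocks(Γ) − 1) · t.
  Expansion : Edges (suc m) → Partition (suc m) → (Fin (suc m) → Bool) → ℕ → Carrier → Set ℓ
  Expansion E Γ A d t = (ConnectedOn A E → pow (q - 1#) d * upperSum Γ E ≈ pow (q - 1#) m * t)
                      × (¬ ConnectedOn A E → upperSum Γ E ≈ 0#)

  expansion-[] : ∀ {Γ A d} → Transversal Γ A [] → count A Nat.+ d ≡ suc m → Expansion [] Γ A d 1#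
  expansion-[] {Γ} {A} {d} T cnt = connected , disconnected
    where
    connected : ConnectedOn A [] → pow (q - 1#) d * upperSum Γ [] ≈ pow (q - 1#) m * 1#
    connected C = begin
      pow (q - 1#) d * upperSum Γ []                  ≈⟨ *-cong ≈-refl (upperSum-[] Γ) ⟩
      pow (q - 1#) d * (if eqP Γ (top (suc m)) then 1# else 0#)
                                                      ≡⟨ cong (λ b → pow (q - 1#) d * (if b then 1# else 0#)) Γ≈top ⟩
      pow (q - 1#) d * 1#                             ≡⟨ cong (λ e → pow (q - 1#) e * 1#) d≡m ⟩
      pow (q - 1#) m * 1#                             ∎
      where
      Γ≈top = transversal-top⁺ T (connectedOn-[]⁻ C)
      d≡m : d ≡ m
      d≡m = ℕₚ.suc-injective (trans (cong (Nat._+ d) (sym (count-subsingleton T Fin.zero (connectedOn-[]⁻ C)))) cnt)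
    disconnected : ¬ ConnectedOn A [] → upperSum Γ [] ≈ 0#
    disconnected ¬C = ≈-trans (upperSum-[] Γ) (reflexive (cong (λ b → if b then 1# else 0#) Γ≉top))
      where
      Γ≉top = ≢true⇒≡false (λ Γ≈top → ¬C (connectedOn-[]⁺ (transversal-top⁻ T Γ≈top)))

  expansion-loop : ∀ {Γ A d t u v es} → u ≡ v → Expansion es Γ A d t → Expansion ((u , v) ∷ es) Γ A d (q * t)
  expansion-loop {Γ} {A} {d} {t} {u} {v} {es} u≡v (ih-connected , ih-disconnected) = connected , disconnected
    where
    connected : ConnectedOn A ((u , v) ∷ es) → pow (q - 1#) d * upperSum Γ ((u , v) ∷ es) ≈ pow (q - 1#) m * (q * t)
    connected C = begin
      pow (q - 1#) d * upperSum Γ ((u , v) ∷ es) ≈⟨ *-cong ≈-refl (upperSum-loop Γ u≡v) ⟩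
      pow (q - 1#) d * (q * upperSum Γ es) ≈⟨ x∙yz≈y∙xz _ _ _ ⟩
      q * (pow (q - 1#) d * upperSum Γ es) ≈⟨ *-cong ≈-refl (ih-connected (connectedOn-loop u≡v C)) ⟩
      q * (pow (q - 1#) m * t)        ≈⟨ x∙yz≈y∙xz _ _ _ ⟩
      pow (q - 1#) m * (q * t)        ∎
    disconnected : ¬ ConnectedOn A ((u , v) ∷ es) → upperSum Γ ((u , v) ∷ es) ≈ 0#
    disconnected ¬C = ≈-trans (upperSum-loop Γ u≡v)
                              (≈-trans (*-cong ≈-refl (ih-disconnected (¬C ∘ connectedOn-tail))) (zeroʳ q))

  module _ {Γ A d t t′ u v es} (T : Transversal Γ A ((u , v) ∷ es)) (u≢v : u ≢ v)
           (deleted : Expansion es Γ A d t)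
           (contracted : Expansion (contractE u v es) (merge Γ u v) (remove A v) (suc d) t′) where

    private
      E  = (u , v) ∷ es
      S  = upperSum Γ es
      S′ = upperSum (merge Γ u v) (contractE u v es)

    disconnected-delete-contract : ¬ ConnectedOn A E → upperSum Γ E ≈ 0#
    disconnected-delete-contract ¬C = begin
      upperSum Γ E       ≈⟨ upperSum-delete-contract Γ u v es ⟩
      S + (q - 1#) * S′  ≈⟨ +-cong (proj₂ deleted (¬C ∘ connectedOn-tail))
                                   (*-cong ≈-refl (proj₂ contracted (¬C ∘ connectedOn-uncontract T u≢v))) ⟩
      0# + (q - 1#) * 0# ≈⟨ +-identityˡ _ ⟩
      (q - 1#) * 0#      ≈⟨ zeroʳ _ ⟩
      0#                 ∎

    connected-contract : ConnectedOn A E → pow (q - 1#) d * ((q - 1#) * S′) ≈ pow (q - 1#) m * t′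
    connected-contract C = ≈-trans (x∙yz≈yx∙z _ _ _) (proj₁ contracted (connectedOn-contract T u≢v C))

    expansion-ordinary : Walk es u v → Expansion E Γ A d (t′ + t)
    expansion-ordinary p = connected , disconnected-delete-contract
      where
      connected : ConnectedOn A E → pow (q - 1#) d * upperSum Γ E ≈ pow (q - 1#) m * (t′ + t)
      connected C = begin
        pow (q - 1#) d * upperSum Γ E                                ≈⟨ *-cong ≈-refl (upperSum-delete-contract Γ u v es) ⟩
        pow (q - 1#) d * (S + (q - 1#) * S′)                         ≈⟨ distribˡ _ _ _ ⟩
        pow (q - 1#) d * S + pow (q - 1#) d * ((q - 1#) * S′)        ≈⟨ +-cong (proj₁ deleted (connectedOn-bypass p C))
                                                                                (connected-contract C) ⟩
        pow (q - 1#) m * t + pow (q - 1#) m * t′                     ≈⟨ +-comm _ _ ⟩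
        pow (q - 1#) m * t′ + pow (q - 1#) m * t                     ≈⟨ distribˡ _ _ _ ⟨
        pow (q - 1#) m * (t′ + t)                                    ∎

    expansion-bridge : ¬ Walk es u v → Expansion E Γ A d (1# * t′)
    expansion-bridge ¬p = connected , disconnected-delete-contract
      where
      ¬connected-deleted : ¬ ConnectedOn A es
      ¬connected-deleted C = let Au , Av = Transversal.endpoints T (here refl) in ¬p (C u v Au Av)
      connected : ConnectedOn A E → pow (q - 1#) d * upperSum Γ E ≈ pow (q - 1#) m * (1# * t′)
      connected C = begin
        pow (q - 1#) d * upperSum Γ E         ≈⟨ *-cong ≈-refl (upperSum-delete-contract Γ u v es) ⟩
        pow (q - 1#) d * (S + (q - 1#) * S′)  ≈⟨ *-cong ≈-refl (+-cong (proj₂ deleted ¬connected-deleted) ≈-refl) ⟩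
        pow (q - 1#) d * (0# + (q - 1#) * S′) ≈⟨ *-cong ≈-refl (+-identityˡ _) ⟩
        pow (q - 1#) d * ((q - 1#) * S′)      ≈⟨ connected-contract C ⟩
        pow (q - 1#) m * t′                   ≈⟨ *-cong ≈-refl (*-identityˡ t′) ⟨
        pow (q - 1#) m * (1# * t′)            ∎

    expansion-non-loop : Expansion E Γ A d (if not (reach (suc m) es u v) then 1# * t′ else t′ + t)
    expansion-non-loop with reach (suc m) es u v in reach-uv
    ... | true  = expansion-ordinary (reach-sound (suc m) reach-uv)
    ... | false = expansion-bridge (λ p → true≢false (trans (sym (walk⇒reach-n p)) reach-uv))

  expansion-tutte : ∀ k E → length E ≡ k → ∀ {Γ A} d → Transversal Γ A E → count A Nat.+ d ≡ suc m →
                Expansion E Γ A d (tutteF k 1# q E)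
  expansion-tutte k       []             _   d T cnt = expansion-[] T cnt
  expansion-tutte (suc k) ((u , v) ∷ es) len {Γ} {A} d T cnt with eqF u v in u≟v
  ... | true  = expansion-loop {Γ} {A} {d} (eqF-true⁻ u≟v)
                  (expansion-tutte k es (ℕₚ.suc-injective len) d (transversal-tail T) cnt)
  ... | false = expansion-non-loop {Γ} {A} {d} T u≢v (expansion-tutte k es (ℕₚ.suc-injective len) d (transversal-tail T) cnt)
                  (expansion-tutte k (contractE u v es) (trans (Listₚ.length-map _ es) (ℕₚ.suc-injective len))
                               (suc d) (transversal-contract T u≢v) cnt′)
    where
    u≢v : u ≢ v
    u≢v u≡v = true≢false (trans (sym (eqF-true⁺ u≡v)) u≟v)
    cnt′ : count (remove A v) Nat.+ suc d ≡ suc m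
    cnt′ = trans (ℕₚ.+-suc _ d)
                 (trans (cong (Nat._+ d) (sym (count-remove {f = A} v (proj₂ (Transversal.endpoints T (here refl))))))
                        cnt)


proposition4p1 : ∀ {c ℓ : Level} (R : CommutativeRing c ℓ) (m : ℕ) (E : Edges (suc m))
                 (q : CommutativeRing.Carrier R) →
                 let open CommutativeRing R
                     open WithRing R
                 in (Connected E → partitionSum E q ≈ pow (q - 1#) m * tutte 1# q E)
                    × (¬ Connected E → partitionSum E q ≈ 0#)
proposition4p1 R m E q = connected , disconnected
  where
  open CommutativeRing R renaming (refl to ≈-refl; sym to ≈-sym; trans to ≈-trans)
  open WithRing R
  open UpperSums R q (suc m)
  open TutteExpansion R q m

  expansion : Expansion E (discrete (suc m)) (λ _ → true) 0 (tutte 1# q E)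
  expansion = expansion-tutte (length E) E refl 0 (transversal-discrete E) (trans (ℕₚ.+-identityʳ _) count-true)

  connected : Connected E → partitionSum E q ≈ pow (q - 1#) m * tutte 1# q E
  connected C = ≈-trans (partitionSum≈upperSum E)
                        (≈-trans (≈-sym (*-identityˡ _)) (proj₁ expansion (λ a b _ _ → C a b)))

  disconnected : ¬ Connected E → partitionSum E q ≈ 0#
  disconnected ¬C = ≈-trans (partitionSum≈upperSum E) (proj₂ expansion (λ C → ¬C (λ a b → C a b refl refl)))
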